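{- Let $k\ge 2$, $c$ and $n$ be integers with $n\ge 1$. Let $f(x)=(a_1x-a_2)(b_1x-b_2)$ with $a_1,a_2,b_1,b_2\in\mathbb{Z}$ and $\gcd(a_1,n)=\gcd(b_1,n)=\gcd(a_1b_2-a_2b_1,n)=1$. Then $$\mathcal{N}_{k,f,c}(n)=(-1)^{k\omega(n)}\prod_{p\mid n}p^{k\nu_p(n)-\nu_p(n)-k}\Big(p\sum_{\substack{j=0\\ (a_2b_1-a_1b_2)j\equiv a_1b_1c-a_1b_2k \pmod p}}^{k}\binom{k}{j}+(2-p)^k-2^k\Big),$$ where the product runs over the distinct prime divisors $p$ of $n$.
   Context: For a positive integer $n$, $\mathbb{Z}_n=\{0,1,\dots,n-1\}$ denotes the ring of residue classes modulo $n$. For $f(x)\in\mathbb{Z}[x]$, let $E_f(n)=\{a\in\mathbb{Z}_n:\gcd(f(a),n)=1\}$ (the $f$-exunits in $\mathbb{Z}_n$), and $$\mathcal{N}_{k,f,c}(n)=\#\{(x_1,\dots,x_k)\in E_f(n)^k: x_1+\cdots+x_k\equiv c\pmod n\}.$$ For a prime $p$ and integer $m\neq 0$, $\nu_p(m)$ is the $p$-adic valuation of $m$, and $\omega(n)$ is the number of distinct prime divisors of $n$. -}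

module Defs where

open import Data.Bool using (Bool; _∧_)
open import Data.Nat as ℕ using (ℕ; zero; suc)
open import Data.Nat.Divisibility using (_∣?_)
open import Data.Nat.Primality using (prime?)
open import Data.Nat.ListAction using (sum)
open import Data.Nat.Combinatorics using (_C_)
open import Data.Integer as ℤ using (ℤ; +_; -[1+_]; ∣_∣)
open import Data.Integer.GCD using () renaming (gcd to gcdℤ)
open import Data.Rational as ℚ using (ℚ; 0ℚ; 1ℚ)
open import Data.List using (List; []; _∷_; map; concatMap; upTo; filterᵇ; length; foldr)
open import Relation.Nullary.Decidable using (⌊_⌋)
open import Data.Integer.Properties using () renaming (_≟_ to _≟ℤ_)

_≡ᵇ_[mod_] : ℤ → ℤ → ℕ → Bool
x ≡ᵇ y [mod m ] = ⌊ m ∣? ∣ x ℤ.- y ∣ ⌋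

fpoly : ℤ → ℤ → ℤ → ℤ → ℤ → ℤ
fpoly a₁ a₂ b₁ b₂ x = (a₁ ℤ.* x ℤ.- a₂) ℤ.* (b₁ ℤ.* x ℤ.- b₂)

isExunit : ℤ → ℤ → ℤ → ℤ → ℕ → ℕ → Bool
isExunit a₁ a₂ b₁ b₂ n a = ⌊ gcdℤ (fpoly a₁ a₂ b₁ b₂ (+ a)) (+ n) ≟ℤ + 1 ⌋

exunits : ℤ → ℤ → ℤ → ℤ → ℕ → List ℕ
exunits a₁ a₂ b₁ b₂ n = filterᵇ (isExunit a₁ a₂ b₁ b₂ n) (upTo n)

tuples : ℕ → List ℕ → List (List ℕ)
tuples zero    xs = [] ∷ []
tuples (suc k) xs = concatMap (λ x → map (x ∷_) (tuples k xs)) xs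

𝒩 : ℕ → ℤ → ℤ → ℤ → ℤ → ℤ → ℕ → ℕ
𝒩 k a₁ a₂ b₁ b₂ c n =
  length (filterᵇ (λ xs → (+ sum xs) ≡ᵇ c [mod n ])
                  (tuples k (exunits a₁ a₂ b₁ b₂ n)))

primeDivisors : ℕ → List ℕ
primeDivisors n = filterᵇ (λ p → ⌊ prime? p ⌋ ∧ ⌊ p ∣? n ⌋) (upTo (suc n))

ω : ℕ → ℕ
ω n = length (primeDivisors n)

-- ν_p(n) for a prime p and n ≥ 1: the largest e with p^e ∣ n, computed as the
-- number of e ∈ {1,…,n} with p^e ∣ n (divisibility by p^e is downward closed,
-- and p^e ∣ n ≥ 1 forces e ≤ n).
ν : ℕ → ℕ → ℕ
ν p n = length (filterᵇ (λ e → ⌊ (p ℕ.^ suc e) ∣? n ⌋) (upTo n))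

-- p^e ∈ ℚ for an integer exponent e (p ≠ 0 intended)
zpow : ℕ → ℤ → ℚ
zpow p (+ m) = (+ (p ℕ.^ m)) ℚ./ 1
zpow p -[1+ m ] with p ℕ.^ suc m
... | zero  = 0ℚ
... | suc d = (+ 1) ℚ./ suc d

sumℤ : List ℤ → ℤ
sumℤ = foldr ℤ._+_ (+ 0)

prodℚ : List ℚ → ℚ
prodℚ = foldr ℚ._*_ 1ℚ

binomSum : ℕ → ℤ → ℤ → ℤ → ℤ → ℤ → ℕ → ℤ
binomSum k a₁ a₂ b₁ b₂ c p =
  sumℤ (map (λ j → + (k C j))
    (filterᵇ (λ j → ((a₂ ℤ.* b₁ ℤ.- a₁ ℤ.* b₂) ℤ.* + j)
                       ≡ᵇ (a₁ ℤ.* b₁ ℤ.* c ℤ.- a₁ ℤ.* b₂ ℤ.* + k) [mod p ])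
             (upTo (suc k))))

localFactor : ℕ → ℤ → ℤ → ℤ → ℤ → ℤ → ℕ → ℕ → ℚ
localFactor k a₁ a₂ b₁ b₂ c n p =
  zpow p (+ (k ℕ.* ν p n) ℤ.- + (ν p n) ℤ.- + k)
  ℚ.* ((+ p ℤ.* binomSum k a₁ a₂ b₁ b₂ c p
         ℤ.+ (+ 2 ℤ.- + p) ℤ.^ k ℤ.- (+ 2) ℤ.^ k) ℚ./ 1)

rhs : ℕ → ℤ → ℤ → ℤ → ℤ → ℤ → ℕ → ℚ
rhs k a₁ a₂ b₁ b₂ c n =
  ((ℤ.- + 1) ℤ.^ (k ℕ.* ω n)) ℚ./ 1
  ℚ.* prodℚ (map (localFactor k a₁ a₂ b₁ b₂ c n) (primeDivisors n))

{-# OPTIONS --safe #-}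
module Submission where

-- Let count u k s be the number of k-tuples of f-exunits mod u with sum ≡ s (mod u); fixing the last
-- coordinate gives count u (k+1) s = Σ_x [x ∈ E_f(u)] count u k (s - x). Being an exunit mod u is a
-- condition modulo each prime factor of u, so by the Chinese remainder theorem count is multiplicative
-- in u, and since the exunits mod p^(e+1) are the lifts of those mod p, count (p^(e+1)) k = p^((k-1)e) count p k.
-- Modulo a prime p the hypotheses give f exactly two distinct roots r₁, r₂, so E_f(p) = ℤ_p ∖ {r₁, r₂} and
-- count p (k+1) s = (p-2)^k - count p k (s - r₁) - count p k (s - r₂). The binomial sum B_k(s) of the
-- statement obeys Pascal's recurrence in the same shape, B_(k+1)(s) = B_k(s - r₁) + B_k(s - r₂), and
-- induction on k gives p B_k(s) + (2-p)^k - 2^k = (-1)^k p count p k s: each local factor is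
-- (-1)^k count (p^ν) k c.

open import Defs

open import Data.Bool using (Bool; true; false; _∧_)
open import Data.Bool.Properties using (T-∧)
open import Data.Nat hiding (∣_-_∣; _≡ᵇ_; _/_)
open import Data.Nat.Properties
open import Data.Nat.Induction using (<-wellFounded)
open import Data.Nat.Tactic.RingSolver using (solve-∀)
open import Data.Nat.Divisibility as ℕ∣ using (_∣_; _∣?_)
open import Data.Nat.DivMod using (m<n⇒m%n≡m)
open import Data.Nat.GCD using (module Bézout)
open import Data.Nat.Coprimality as Coprime
  using (Coprime; coprime?; coprime-Bézout; coprime-divisor; gcd≡1⇒coprime; coprime⇒gcd≡1)
open import Data.Nat.Primality using (Prime; prime?; prime⇒irreducible; prime⇒nonZero; prime⇒nonTrivial; euclidsLemma)
open import Data.Nat.Primality.Factorisation using (factorise)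
open import Data.Nat.Combinatorics using (_C_; nCk+nC[k+1]≡[n+1]C[k+1]; k>n⇒nCk≡0)
open import Data.Nat.ListAction using (sum; product)
open import Data.Integer as ℤ using (ℤ; +_; -[1+_]; ∣_∣; _-_; -_)
import Data.Integer.Properties as ℤ
import Data.Integer.Tactic.RingSolver as ℤ-Ring
open import Data.Integer.Divisibility.Signed as ℤ∣ using (divides)
open import Data.Integer.DivMod using (_%ℕ_; _/ℕ_; n%ℕd<d; a≡a%ℕn+[a/ℕn]*n)
open import Data.Integer.GCD using (gcd)
open import Data.Rational as ℚ using (ℚ; _/_; toℚᵘ; ↥_; ↧_)
import Data.Rational.Properties as ℚ
open import Data.Rational.Unnormalised using (mkℚᵘ; *≡*) renaming (_≃_ to _≃ᵘ_; ↥_ to ↥ᵘ_; ↧_ to ↧ᵘ_)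
import Data.Rational.Unnormalised.Properties as ℚᵘ
open import Data.List using (List; []; _∷_; _++_; map; concatMap; filterᵇ; length; applyUpTo; upTo)
open import Data.List.Properties using (filter-++; length-++; map-cong; map-cong-local)
open import Data.List.Relation.Unary.All as All using (_∷_)
open import Data.List.Relation.Unary.Any using (here; there)
open import Data.List.Relation.Unary.AllPairs using (_∷_)
open import Data.List.Relation.Unary.Unique.Propositional using (Unique)
import Data.List.Relation.Unary.Unique.Propositional.Properties as Unique
open import Data.List.Membership.Propositional using (_∈_)
open import Data.List.Membership.Propositional.Properties using (∈-filter⁻; ∈-filter⁺; ∈-upTo⁺)
open import Data.Product using (_×_; _,_; proj₁; proj₂; ∃)
open import Data.Sum using (_⊎_; inj₁; inj₂)
open import Function using (_∘_; id)
open import Function.Bundles using (_⇔_; mk⇔; Equivalence)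
open import Induction.WellFounded using (Acc; acc)
open import Level using (0ℓ)
open import Relation.Nullary using (¬_; Dec; yes; no; does; map′; _×-dec_)
open import Relation.Nullary.Decidable using (does-⇔; isYes≗does; isYes; ⌊_⌋; dec-true; dec-false; T?; toWitness; fromWitness)
open import Relation.Nullary.Negation using (contradiction)
open import Relation.Binary.Bundles using (Setoid)
open import Relation.Binary.PropositionalEquality
import Relation.Binary.Reasoning.Setoid as SetoidReasoning

∑ : ℕ → (ℕ → ℕ) → ℕ
∑ zero    f = 0
∑ (suc n) f = f 0 + ∑ n (f ∘ suc)

χ : Bool → ℕ
χ true  = 1
χ false = 0

χ-∧ : ∀ a b → χ (a ∧ b) ≡ χ a * χ b
χ-∧ true  b = sym (+-identityʳ (χ b))
χ-∧ false b = refl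

⌊⌋-⇔ : ∀ {A B : Set} → A ⇔ B → (a? : Dec A) (b? : Dec B) → ⌊ a? ⌋ ≡ ⌊ b? ⌋
⌊⌋-⇔ A⇔B a? b? = trans (isYes≗does a?) (trans (does-⇔ A⇔B a? b?) (sym (isYes≗does b?)))

∑-cong : ∀ n {f g : ℕ → ℕ} → (∀ {i} → i < n → f i ≡ g i) → ∑ n f ≡ ∑ n g
∑-cong zero    f≡g = refl
∑-cong (suc n) f≡g = cong₂ _+_ (f≡g z<s) (∑-cong n (f≡g ∘ s<s))

∑-cong′ : ∀ n {f g : ℕ → ℕ} → f ≗ g → ∑ n f ≡ ∑ n g
∑-cong′ n f≗g = ∑-cong n (λ {i} _ → f≗g i)

∑-distrib-+ : ∀ n (f g : ℕ → ℕ) → ∑ n (λ i → f i + g i) ≡ ∑ n f + ∑ n g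
∑-distrib-+ zero    f g = refl
∑-distrib-+ (suc n) f g
  rewrite ∑-distrib-+ n (f ∘ suc) (g ∘ suc) = +-+-comm (f 0) (g 0) _ _
  where
  +-+-comm : ∀ a b c d → (a + b) + (c + d) ≡ (a + c) + (b + d)
  +-+-comm = solve-∀

∑-*ˡ : ∀ n c (f : ℕ → ℕ) → ∑ n (λ i → c * f i) ≡ c * ∑ n f
∑-*ˡ zero    c f = sym (*-zeroʳ c)
∑-*ˡ (suc n) c f rewrite ∑-*ˡ n c (f ∘ suc) = sym (*-distribˡ-+ c (f 0) _)

∑-*ʳ : ∀ n c (f : ℕ → ℕ) → ∑ n (λ i → f i * c) ≡ ∑ n f * c
∑-*ʳ n c f = begin
  ∑ n (λ i → f i * c) ≡⟨ ∑-cong′ n (λ i → *-comm (f i) c) ⟩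
  ∑ n (λ i → c * f i) ≡⟨ ∑-*ˡ n c f ⟩
  c * ∑ n f           ≡⟨ *-comm c _ ⟩
  ∑ n f * c           ∎
  where open ≡-Reasoning

∑-const : ∀ n c → ∑ n (λ _ → c) ≡ n * c
∑-const zero    c = refl
∑-const (suc n) c = cong (_+_ c) (∑-const n c)

∑-zero : ∀ n → ∑ n (λ _ → 0) ≡ 0
∑-zero n = trans (∑-const n 0) (*-zeroʳ n)

∑-+ : ∀ m q (f : ℕ → ℕ) → ∑ (m + q) f ≡ ∑ m f + ∑ q (λ i → f (m + i))
∑-+ zero    q f = refl
∑-+ (suc m) q f rewrite ∑-+ m q (f ∘ suc) = sym (+-assoc (f 0) _ _)

∑-last : ∀ n (f : ℕ → ℕ) → ∑ (suc n) f ≡ ∑ n f + f n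
∑-last n f = begin
  ∑ (suc n) f                    ≡⟨ cong (λ m → ∑ m f) (+-comm 1 n) ⟩
  ∑ (n + 1) f                    ≡⟨ ∑-+ n 1 f ⟩
  ∑ n f + (f (n + 0) + 0)        ≡⟨ cong (λ x → ∑ n f + x) (trans (+-identityʳ _) (cong f (+-identityʳ n))) ⟩
  ∑ n f + f n                    ∎
  where open ≡-Reasoning

∑-comm : ∀ m q (f : ℕ → ℕ → ℕ) → ∑ m (λ i → ∑ q (f i)) ≡ ∑ q (λ j → ∑ m (λ i → f i j))
∑-comm zero    q f = sym (∑-zero q)
∑-comm (suc m) q f rewrite ∑-comm m q (f ∘ suc) = sym (∑-distrib-+ q (f 0) _)

∑-* : ∀ q m (f : ℕ → ℕ) → ∑ (q * m) f ≡ ∑ q (λ t → ∑ m (λ y → f (m * t + y)))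
∑-* zero    m f = refl
∑-* (suc q) m f = begin
  ∑ (m + q * m) f                                          ≡⟨ ∑-+ m (q * m) f ⟩
  ∑ m f + ∑ (q * m) (λ i → f (m + i))                      ≡⟨ cong₂ _+_ (∑-cong′ m (λ y → cong (λ t → f (t + y)) (sym (*-zeroʳ m))))
                                                                        (∑-* q m (λ i → f (m + i))) ⟩
  ∑ m (λ y → f (m * 0 + y)) + ∑ q (λ t → ∑ m (λ y → f (m + (m * t + y))))
                                                           ≡⟨ cong (_+_ (∑ m (λ y → f (m * 0 + y))))
                                                                (∑-cong′ q (λ t → ∑-cong′ m (λ y → cong f (next-block m t y)))) ⟩
  ∑ (suc q) (λ t → ∑ m (λ y → f (m * t + y)))               ∎
  where
  open ≡-Reasoning
  next-block : ∀ m t y → m + (m * t + y) ≡ m * suc t + y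
  next-block = solve-∀

∑-indicator : ∀ n {t} → t < n → (g : ℕ → ℕ) → ∑ n (λ y → χ ⌊ y ≟ t ⌋ * g y) ≡ g t
∑-indicator (suc n) {zero}  _         g = trans (cong₂ _+_ (+-identityʳ (g 0)) (∑-zero n)) (+-identityʳ (g 0))
∑-indicator (suc n) {suc t} (s<s t<n) g =
  trans (∑-cong′ n (λ y → cong (λ b → χ b * g (suc y)) (⌊⌋-⇔ (mk⇔ suc-injective (cong suc)) (suc y ≟ suc t) (y ≟ t))))
        (∑-indicator n t<n (g ∘ suc))

∑-< : ∀ n {e} → e ≤ n → ∑ n (λ i → χ ⌊ i <? e ⌋) ≡ e
∑-< n       {zero}  _         = ∑-zero n
∑-< (suc n) {suc e} (s≤s e≤n) =
  cong suc (trans (∑-cong′ n (λ i → cong χ (⌊⌋-⇔ (mk⇔ s≤s⁻¹ s≤s) (suc i <? suc e) (i <? e)))) (∑-< n e≤n))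

∑-pascal : ∀ k (g : ℕ → ℕ) →
           ∑ (2 + k) (λ j → g j * (suc k C j)) ≡ ∑ (suc k) (λ j → g (suc j) * (k C j)) + ∑ (suc k) (λ j → g j * (k C j))
∑-pascal k g = begin
  g 0 * 1 + ∑ (suc k) (λ j → g (suc j) * (suc k C suc j))
    ≡⟨ cong (_+_ (g 0 * 1)) (∑-cong′ (suc k) (λ j → trans (cong (g (suc j) *_) (sym (nCk+nC[k+1]≡[n+1]C[k+1] k j)))
                                                          (*-distribˡ-+ (g (suc j)) (k C j) (k C suc j)))) ⟩
  g 0 * 1 + ∑ (suc k) (λ j → g (suc j) * (k C j) + g (suc j) * (k C suc j))
    ≡⟨ cong (_+_ (g 0 * 1)) (∑-distrib-+ (suc k) (λ j → g (suc j) * (k C j)) (λ j → g (suc j) * (k C suc j))) ⟩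
  g 0 * 1 + (A + ∑ (suc k) (λ j → g (suc j) * (k C suc j)))
    ≡⟨ x+[y+z]≡y+[x+z] (g 0 * 1) A _ ⟩
  A + ∑ (2 + k) (λ j → g j * (k C j))
    ≡⟨ cong (_+_ A) (∑-last (suc k) (λ j → g j * (k C j))) ⟩
  A + (∑ (suc k) (λ j → g j * (k C j)) + g (suc k) * (k C suc k))
    ≡⟨ cong (λ z → A + (∑ (suc k) (λ j → g j * (k C j)) + g (suc k) * z)) (k>n⇒nCk≡0 (n<1+n k)) ⟩
  A + (∑ (suc k) (λ j → g j * (k C j)) + g (suc k) * 0)
    ≡⟨ cong (λ z → A + z) (trans (cong (_+_ _) (*-zeroʳ (g (suc k)))) (+-identityʳ _)) ⟩
  A + ∑ (suc k) (λ j → g j * (k C j))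
    ∎
  where
  open ≡-Reasoning
  A : ℕ
  A = ∑ (suc k) (λ j → g (suc j) * (k C j))
  x+[y+z]≡y+[x+z] : ∀ x y z → x + (y + z) ≡ y + (x + z)
  x+[y+z]≡y+[x+z] = solve-∀

-- Periodic summands and the Chinese remainder theorem

Periodic : ℕ → (ℕ → ℕ) → Set
Periodic q G = ∀ x → G (x + q) ≡ G x

periodic-* : ∀ {q} {G : ℕ → ℕ} → Periodic q G → ∀ a x → G (x + a * q) ≡ G x
periodic-* {q} {G} per zero    x = cong G (+-identityʳ x)
periodic-* {q} {G} per (suc a) x = begin
  G (x + (q + a * q)) ≡⟨ cong G (sym (+-assoc x q (a * q))) ⟩
  G (x + q + a * q)   ≡⟨ periodic-* per a (x + q) ⟩
  G (x + q)           ≡⟨ per x ⟩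
  G x                 ∎
  where open ≡-Reasoning

∑-periodic-suc : ∀ q {G : ℕ → ℕ} → Periodic q G → ∑ q (G ∘ suc) ≡ ∑ q G
∑-periodic-suc zero    per = refl
∑-periodic-suc (suc q) {G} per = begin
  ∑ (suc q) (G ∘ suc)        ≡⟨ ∑-last q (G ∘ suc) ⟩
  ∑ q (G ∘ suc) + G (suc q)  ≡⟨ cong (_+_ (∑ q (G ∘ suc))) (per 0) ⟩
  ∑ q (G ∘ suc) + G 0        ≡⟨ +-comm _ (G 0) ⟩
  ∑ (suc q) G                ∎
  where open ≡-Reasoning

∑-periodic-shift : ∀ q {G : ℕ → ℕ} → Periodic q G → ∀ a → ∑ q (λ y → G (y + a)) ≡ ∑ q G
∑-periodic-shift q {G} per zero    = ∑-cong′ q (λ y → cong G (+-identityʳ y))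
∑-periodic-shift q {G} per (suc a) = begin
  ∑ q (λ y → G (y + suc a))   ≡⟨ ∑-cong′ q (λ y → cong G (+-suc y a)) ⟩
  ∑ q (λ y → G (suc y + a))   ≡⟨ ∑-periodic-suc q shifted ⟩
  ∑ q (λ y → G (y + a))       ≡⟨ ∑-periodic-shift q per a ⟩
  ∑ q G                       ∎
  where
  open ≡-Reasoning
  shifted : Periodic q (λ y → G (y + a))
  shifted x = trans (cong G (+-comm-middle x q a)) (per (x + a))
    where
    +-comm-middle : ∀ x q a → x + q + a ≡ x + a + q
    +-comm-middle = solve-∀

∑-periodic-* : ∀ a m {H : ℕ → ℕ} → Periodic m H → ∑ (a * m) H ≡ a * ∑ m H
∑-periodic-* a m {H} per = begin
  ∑ (a * m) H                             ≡⟨ ∑-* a m H ⟩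
  ∑ a (λ t → ∑ m (λ y → H (m * t + y)))   ≡⟨ ∑-cong′ a (λ t → ∑-cong′ m (λ y → trans (cong H (block t y)) (periodic-* per t y))) ⟩
  ∑ a (λ _ → ∑ m H)                       ≡⟨ ∑-const a (∑ m H) ⟩
  a * ∑ m H                               ∎
  where
  open ≡-Reasoning
  block : ∀ t y → m * t + y ≡ y + t * m
  block t y = trans (+-comm (m * t) y) (cong (_+_ y) (*-comm m t))

coprime-periods⇒constant : ∀ {m q} {φ : ℕ → ℕ} → Coprime m q → Periodic m φ → Periodic q φ → ∀ z → φ z ≡ φ 0
coprime-periods⇒constant {m} {q} {φ} cop perm perq = constant
  where
  -- By Bézout a multiple of m and a multiple of q differ by 1.
  step : ∀ z → φ (suc z) ≡ φ z
  step z with coprime-Bézout cop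
  ... | Bézout.+- x y eq = begin
    φ (suc z)             ≡⟨ periodic-* perq y (suc z) ⟨
    φ (suc z + y * q)     ≡⟨ cong φ (trans (sym (+-suc z (y * q))) (cong (_+_ z) eq)) ⟩
    φ (z + x * m)         ≡⟨ periodic-* perm x z ⟩
    φ z                   ∎
    where open ≡-Reasoning
  ... | Bézout.-+ x y eq = begin
    φ (suc z)             ≡⟨ periodic-* perm x (suc z) ⟨
    φ (suc z + x * m)     ≡⟨ cong φ (trans (sym (+-suc z (x * m))) (cong (_+_ z) eq)) ⟩
    φ (z + y * q)         ≡⟨ periodic-* perq y z ⟩
    φ z                   ∎
    where open ≡-Reasoning
  constant : ∀ z → φ z ≡ φ 0
  constant zero    = refl
  constant (suc z) = trans (step z) (constant z)

-- φ y = ∑ q (λ t → G (y + t * m)) has both periods m and q, hence is constant, and averaging it over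
-- y < q identifies the constant as ∑ q G.
∑-coprime-stride : ∀ {m q} .{{_ : NonZero q}} {G : ℕ → ℕ} → Coprime m q → Periodic q G →
                   ∀ y → ∑ q (λ t → G (y + t * m)) ≡ ∑ q G
∑-coprime-stride {m} {q} {G} cop perG y =
  trans (coprime-periods⇒constant cop φ-periodic-m φ-periodic-q y) φ0≡∑G
  where
  open ≡-Reasoning
  φ : ℕ → ℕ
  φ y = ∑ q (λ t → G (y + t * m))
  φ-periodic-q : Periodic q φ
  φ-periodic-q z = ∑-cong′ q (λ t → trans (cong G (+-comm-middle z q (t * m))) (perG (z + t * m)))
    where
    +-comm-middle : ∀ x q a → x + q + a ≡ x + a + q
    +-comm-middle = solve-∀
  φ-periodic-m : Periodic m φ
  φ-periodic-m z = begin
    ∑ q (λ t → G (z + m + t * m))       ≡⟨ ∑-cong′ q (λ t → cong G (next z m t)) ⟩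
    ∑ q (λ t → G (z + suc t * m))       ≡⟨ ∑-periodic-suc q (λ t → trans (cong G (wrap z m t q)) (periodic-* perG m (z + t * m))) ⟩
    φ z                                 ∎
    where
    next : ∀ z m t → z + m + t * m ≡ z + suc t * m
    next = solve-∀
    wrap : ∀ z m t q → z + (t + q) * m ≡ z + t * m + m * q
    wrap = solve-∀
  q*φ0≡q*∑G : q * φ 0 ≡ q * ∑ q G
  q*φ0≡q*∑G = begin
    q * φ 0                             ≡⟨ ∑-const q (φ 0) ⟨
    ∑ q (λ _ → φ 0)                     ≡⟨ ∑-cong′ q (coprime-periods⇒constant cop φ-periodic-m φ-periodic-q) ⟨
    ∑ q φ                               ≡⟨ ∑-comm q q (λ y t → G (y + t * m)) ⟩
    ∑ q (λ t → ∑ q (λ y → G (y + t * m))) ≡⟨ ∑-cong′ q (λ t → ∑-periodic-shift q perG (t * m)) ⟩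
    ∑ q (λ _ → ∑ q G)                   ≡⟨ ∑-const q (∑ q G) ⟩
    q * ∑ q G                           ∎
  φ0≡∑G : φ 0 ≡ ∑ q G
  φ0≡∑G = *-cancelˡ-≡ (φ 0) (∑ q G) q q*φ0≡q*∑G

∑-*-coprime : ∀ m q .{{_ : NonZero q}} → Coprime m q → {F G : ℕ → ℕ} → Periodic m F → Periodic q G →
              ∑ (m * q) (λ x → F x * G x) ≡ ∑ m F * ∑ q G
∑-*-coprime m q cop {F} {G} perF perG = begin
  ∑ (m * q) (λ x → F x * G x)                                   ≡⟨ cong (λ z → ∑ z (λ x → F x * G x)) (*-comm m q) ⟩
  ∑ (q * m) (λ x → F x * G x)                                   ≡⟨ ∑-* q m _ ⟩
  ∑ q (λ t → ∑ m (λ y → F (m * t + y) * G (m * t + y)))         ≡⟨ ∑-comm q m _ ⟩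
  ∑ m (λ y → ∑ q (λ t → F (m * t + y) * G (m * t + y)))         ≡⟨ ∑-cong′ m (λ y → ∑-cong′ q (λ t →
                                                                     cong₂ _*_ (trans (cong F (block t y)) (periodic-* perF t y)) (cong G (block t y)))) ⟩
  ∑ m (λ y → ∑ q (λ t → F y * G (y + t * m)))                   ≡⟨ ∑-cong′ m (λ y → ∑-*ˡ q (F y) _) ⟩
  ∑ m (λ y → F y * ∑ q (λ t → G (y + t * m)))                   ≡⟨ ∑-cong′ m (λ y → cong (F y *_) (∑-coprime-stride cop perG y)) ⟩
  ∑ m (λ y → F y * ∑ q G)                                       ≡⟨ ∑-*ʳ m (∑ q G) F ⟩
  ∑ m F * ∑ q G                                                 ∎
  where
  open ≡-Reasoning
  block : ∀ t y → m * t + y ≡ y + t * m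
  block t y = trans (+-comm (m * t) y) (cong (_+_ y) (*-comm m t))

length-filterᵇ-++ : ∀ {A : Set} (P : A → Bool) xs ys →
                    length (filterᵇ P (xs ++ ys)) ≡ length (filterᵇ P xs) + length (filterᵇ P ys)
length-filterᵇ-++ P xs ys = trans (cong length (filter-++ _ xs ys)) (length-++ (filterᵇ P xs))

length-filterᵇ-concatMap : ∀ {A B : Set} (P : B → Bool) (h : A → List B) xs →
                           length (filterᵇ P (concatMap h xs)) ≡ sum (map (λ x → length (filterᵇ P (h x))) xs)
length-filterᵇ-concatMap P h []       = refl
length-filterᵇ-concatMap P h (x ∷ xs) =
  trans (length-filterᵇ-++ P (h x) (concatMap h xs)) (cong (_+_ _) (length-filterᵇ-concatMap P h xs))

length-filterᵇ-map-∷ : ∀ {A : Set} (P : List A → Bool) x yss →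
                       length (filterᵇ P (map (x ∷_) yss)) ≡ length (filterᵇ (P ∘ (x ∷_)) yss)
length-filterᵇ-map-∷ P x []         = refl
length-filterᵇ-map-∷ P x (ys ∷ yss) with P (x ∷ ys)
... | true  = cong suc (length-filterᵇ-map-∷ P x yss)
... | false = length-filterᵇ-map-∷ P x yss

length-filterᵇ-cong : ∀ {A : Set} {P Q : A → Bool} → P ≗ Q → ∀ xs → length (filterᵇ P xs) ≡ length (filterᵇ Q xs)
length-filterᵇ-cong             P≗Q []       = refl
length-filterᵇ-cong {P = P} {Q} P≗Q (x ∷ xs) with P x | Q x | P≗Q x
... | true  | true  | refl = cong suc (length-filterᵇ-cong P≗Q xs)
... | false | false | refl = length-filterᵇ-cong P≗Q xs

sum-map-filterᵇ-applyUpTo : ∀ (P : ℕ → Bool) (f : ℕ → ℕ) n (g : ℕ → ℕ) →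
                            sum (map g (filterᵇ P (applyUpTo f n))) ≡ ∑ n (λ i → χ (P (f i)) * g (f i))
sum-map-filterᵇ-applyUpTo P f zero    g = refl
sum-map-filterᵇ-applyUpTo P f (suc n) g with P (f 0)
... | true  = cong₂ _+_ (sym (+-identityʳ (g (f 0)))) (sum-map-filterᵇ-applyUpTo P (f ∘ suc) n g)
... | false = sum-map-filterᵇ-applyUpTo P (f ∘ suc) n g

length-filterᵇ-applyUpTo : ∀ (P : ℕ → Bool) f n → length (filterᵇ P (applyUpTo f n)) ≡ ∑ n (χ ∘ P ∘ f)
length-filterᵇ-applyUpTo P f zero    = refl
length-filterᵇ-applyUpTo P f (suc n) with P (f 0)
... | true  = cong suc (length-filterᵇ-applyUpTo P (f ∘ suc) n)
... | false = length-filterᵇ-applyUpTo P (f ∘ suc) n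

sumℤ-map-pos : ∀ (h : ℕ → ℕ) xs → sumℤ (map (λ j → + h j) xs) ≡ + sum (map h xs)
sumℤ-map-pos h []       = refl
sumℤ-map-pos h (x ∷ xs) = trans (cong (ℤ._+_ (+ h x)) (sumℤ-map-pos h xs)) (sym (ℤ.pos-+ (h x) _))

infix 4 _≡_[mod_]
record _≡_[mod_] (a b : ℤ) (u : ℕ) : Set where
  constructor mod
  field ∣-diff : + u ℤ∣.∣ a - b
open _≡_[mod_]

_≡?_[mod_] : ∀ a b u → Dec (a ≡ b [mod u ])
a ≡? b [mod u ] = map′ (mod ∘ ℤ∣.∣ᵤ⇒∣) (ℤ∣.∣⇒∣ᵤ ∘ ∣-diff) (u ∣? ∣ a - b ∣)

module _ {u : ℕ} where

  private
    via : ∀ {a b x} → x ≡ a - b → + u ℤ∣.∣ x → a ≡ b [mod u ]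
    via eq d = mod (subst (+ u ℤ∣.∣_) eq d)

  ≡-mod-reflexive : ∀ {a b} → a ≡ b → a ≡ b [mod u ]
  ≡-mod-reflexive {a} refl = via (sym (ℤ.+-inverseʳ a)) (divides (+ 0) refl)

  ≡-mod-refl : ∀ {a} → a ≡ a [mod u ]
  ≡-mod-refl = ≡-mod-reflexive refl

  ≡-mod-sym : ∀ {a b} → a ≡ b [mod u ] → b ≡ a [mod u ]
  ≡-mod-sym {a} {b} (mod d) = via (negate-diff a b) (ℤ∣.∣m⇒∣-m d)
    where
    negate-diff : ∀ a b → - (a - b) ≡ b - a
    negate-diff = ℤ-Ring.solve-∀

  ≡-mod-trans : ∀ {a b c} → a ≡ b [mod u ] → b ≡ c [mod u ] → a ≡ c [mod u ]
  ≡-mod-trans {a} {b} {c} (mod d) (mod e) = via (telescope a b c) (ℤ∣.∣m∣n⇒∣m+n d e)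
    where
    telescope : ∀ a b c → (a - b) ℤ.+ (b - c) ≡ a - c
    telescope = ℤ-Ring.solve-∀

  +-cong-mod : ∀ {a b c d} → a ≡ b [mod u ] → c ≡ d [mod u ] → a ℤ.+ c ≡ b ℤ.+ d [mod u ]
  +-cong-mod {a} {b} {c} {d} (mod p) (mod q) = via (regroup a b c d) (ℤ∣.∣m∣n⇒∣m+n p q)
    where
    regroup : ∀ a b c d → (a - b) ℤ.+ (c - d) ≡ (a ℤ.+ c) - (b ℤ.+ d)
    regroup = ℤ-Ring.solve-∀

  -‿cong-mod : ∀ {a b} → a ≡ b [mod u ] → - a ≡ - b [mod u ]
  -‿cong-mod {a} {b} (mod p) = via (regroup a b) (ℤ∣.∣m⇒∣-m p)
    where
    regroup : ∀ a b → - (a - b) ≡ - a - - b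
    regroup = ℤ-Ring.solve-∀

  sub-cong-mod : ∀ {a b c d} → a ≡ b [mod u ] → c ≡ d [mod u ] → a - c ≡ b - d [mod u ]
  sub-cong-mod p q = +-cong-mod p (-‿cong-mod q)

  *-cong-mod : ∀ {a b c d} → a ≡ b [mod u ] → c ≡ d [mod u ] → a ℤ.* c ≡ b ℤ.* d [mod u ]
  *-cong-mod {a} {b} {c} {d} (mod p) (mod q) =
    via (regroup a b c d) (ℤ∣.∣m∣n⇒∣m+n (ℤ∣.∣n⇒∣m*n a q) (ℤ∣.∣m⇒∣m*n d p))
    where
    regroup : ∀ a b c d → a ℤ.* (c - d) ℤ.+ (a - b) ℤ.* d ≡ a ℤ.* c - b ℤ.* d
    regroup = ℤ-Ring.solve-∀

  *-congˡ-mod : ∀ c {a b} → a ≡ b [mod u ] → c ℤ.* a ≡ c ℤ.* b [mod u ]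
  *-congˡ-mod c = *-cong-mod (≡-mod-refl {a = c})

  *-congʳ-mod : ∀ c {a b} → a ≡ b [mod u ] → a ℤ.* c ≡ b ℤ.* c [mod u ]
  *-congʳ-mod c a≡b = *-cong-mod a≡b (≡-mod-refl {a = c})

  sub-congˡ-mod : ∀ c {a b} → a ≡ b [mod u ] → c - a ≡ c - b [mod u ]
  sub-congˡ-mod c = sub-cong-mod (≡-mod-refl {a = c})

  ≡-mod⇒-≡0 : ∀ {a b} → a ≡ b [mod u ] → a - b ≡ + 0 [mod u ]
  ≡-mod⇒-≡0 {a} {b} (mod p) = via (sym (ℤ.+-identityʳ (a - b))) p

  -≡0⇒≡-mod : ∀ {a b} → a - b ≡ + 0 [mod u ] → a ≡ b [mod u ]
  -≡0⇒≡-mod {a} {b} (mod p) = via (ℤ.+-identityʳ (a - b)) p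

  ≡-mod-% : ∀ s .{{_ : NonZero u}} → s ≡ + (s %ℕ u) [mod u ]
  ≡-mod-% s = via (quotient-part s (+ (s %ℕ u)) (s /ℕ u) (+ u) (a≡a%ℕn+[a/ℕn]*n s u)) (divides (s /ℕ u) refl)
    where
    quotient-part : ∀ s r q u → s ≡ r ℤ.+ q ℤ.* u → q ℤ.* u ≡ s - r
    quotient-part s r q u refl = remove r (q ℤ.* u)
      where
      remove : ∀ r x → x ≡ r ℤ.+ x - r
      remove = ℤ-Ring.solve-∀

≡-mod-setoid : ℕ → Setoid 0ℓ 0ℓ
≡-mod-setoid u = record
  { Carrier       = ℤ
  ; _≈_           = λ a b → a ≡ b [mod u ]
  ; isEquivalence = record { refl = ≡-mod-refl ; sym = ≡-mod-sym ; trans = ≡-mod-trans }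
  }

module ≡-mod-Reasoning (u : ℕ) = SetoidReasoning (≡-mod-setoid u)

≡0-mod⇔∣ : ∀ {u a} → (a ≡ + 0 [mod u ]) ⇔ (u ∣ ∣ a ∣)
≡0-mod⇔∣ {u} {a} = mk⇔ (λ (mod d) → subst (λ z → u ∣ ∣ z ∣) (ℤ.+-identityʳ a) (ℤ∣.∣⇒∣ᵤ d))
                       (λ u∣a → mod (ℤ∣.∣ᵤ⇒∣ (subst (λ z → u ∣ ∣ z ∣) (sym (ℤ.+-identityʳ a)) u∣a)))

≡-mod-weaken : ∀ {u v a b} → v ∣ u → a ≡ b [mod u ] → a ≡ b [mod v ]
≡-mod-weaken v∣u (mod p) = mod (ℤ∣.∣-trans (ℤ∣.∣ᵤ⇒∣ v∣u) p)

≡-mod-+-modulus : ∀ x u → + (x + u) ≡ + x [mod u ]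
≡-mod-+-modulus x u = mod (divides (+ 1) (trans (cong (_- + x) (ℤ.pos-+ x u)) (cancel (+ x) (+ u))))
  where
  cancel : ∀ x u → (x ℤ.+ u) - x ≡ + 1 ℤ.* u
  cancel = ℤ-Ring.solve-∀

0≡s-x⇔x≡s : ∀ {u s x} → (+ 0 ≡ s - x [mod u ]) ⇔ (x ≡ s [mod u ])
0≡s-x⇔x≡s {u} {s} {x} = mk⇔
  (λ 0≡s-x → ≡-mod-trans (≡-mod-reflexive (sym (ℤ.+-identityˡ x)))
               (≡-mod-trans (+-cong-mod 0≡s-x (≡-mod-refl {a = x})) (≡-mod-reflexive (cancel s x))))
  (λ x≡s → ≡-mod-trans (≡-mod-reflexive (sym (ℤ.+-inverseʳ s))) (sub-cong-mod (≡-mod-refl {a = s}) (≡-mod-sym x≡s)))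
  where
  cancel : ∀ s x → s - x ℤ.+ x ≡ s
  cancel = ℤ-Ring.solve-∀

∣∧<⇒≡0 : ∀ {u d} → u ∣ d → d < u → d ≡ 0
∣∧<⇒≡0 {u@(suc _)} {d} u∣d d<u = trans (sym (m<n⇒m%n≡m d<u)) (ℕ∣.n∣m⇒m%n≡0 d u u∣d)

≤-residue-unique : ∀ {u x r} → x ≤ r → r < u → + x ≡ + r [mod u ] → x ≡ r
≤-residue-unique {u} {x} {r} x≤r r<u (mod d) =
  ≤-antisym x≤r (m∸n≡0⇒m≤n (∣∧<⇒≡0 u∣r∸x (≤-<-trans (m∸n≤m r x) r<u)))
  where
  u∣r∸x : u ∣ r ∸ x
  u∣r∸x = subst (u ∣_) (trans (cong ∣_∣ (ℤ.[+m]-[+n]≡m⊖n x r)) (ℤ.∣⊖∣-≤ x≤r)) (ℤ∣.∣⇒∣ᵤ d)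

residue-unique : ∀ {u x r} → x < u → r < u → + x ≡ + r [mod u ] → x ≡ r
residue-unique {u} {x} {r} x<u r<u x≡r with ≤-total x r
... | inj₁ x≤r = ≤-residue-unique x≤r r<u x≡r
... | inj₂ r≤x = sym (≤-residue-unique r≤x x<u (≡-mod-sym x≡r))

coprime-∣ʳ : ∀ {z n q} → Coprime z n → q ∣ n → Coprime z q
coprime-∣ʳ c q∣n (d∣z , d∣q) = c (d∣z , ℕ∣.∣-trans d∣q q∣n)

coprime-* : ∀ {z u v} → Coprime z u → Coprime z v → Coprime z (u * v)
coprime-* {z} {u} {v} cu cv {d} (d∣z , d∣uv) = cv (d∣z , coprime-divisor d⊥u d∣uv)
  where
  d⊥u : Coprime d u
  d⊥u (e∣d , e∣u) = cu (ℕ∣.∣-trans e∣d d∣z , e∣u)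

coprime-*⇔ : ∀ {z u v} → Coprime z (u * v) ⇔ (Coprime z u × Coprime z v)
coprime-*⇔ {z} {u} {v} = mk⇔ split (λ (c : Coprime z u × Coprime z v) → coprime-* (proj₁ c) (proj₂ c))
  where
  split : Coprime z (u * v) → Coprime z u × Coprime z v
  split c = coprime-∣ʳ c (ℕ∣.m∣m*n v) , coprime-∣ʳ c (ℕ∣.n∣m*n u)

coprime-^ : ∀ {z p} e → Coprime z p → Coprime z (p ^ e)
coprime-^ zero    c (_ , d∣1) = ℕ∣.∣1⇒≡1 d∣1
coprime-^ (suc e) c = coprime-* c (coprime-^ e c)

coprime-^⇔ : ∀ {z p} e → Coprime z (p ^ suc e) ⇔ Coprime z p
coprime-^⇔ {z} {p} e = mk⇔ to (coprime-^ (suc e))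
  where
  to : Coprime z (p ^ suc e) → Coprime z p
  to c = coprime-∣ʳ c (ℕ∣.m∣m*n (p ^ e))

coprime⇒*-∣ : ∀ {u v m} → Coprime u v → u ∣ m → v ∣ m → u * v ∣ m
coprime⇒*-∣ {u} {v} c (ℕ∣.divides a refl) v∣au with coprime-divisor (Coprime.sym c) (subst (v ∣_) (*-comm a u) v∣au)
... | ℕ∣.divides b refl = ℕ∣.divides b (trans (*-assoc b v u) (cong (b *_) (*-comm v u)))

prime>1 : ∀ {p} → Prime p → 1 < p
prime>1 {p} p-prime = nonTrivial⇒n>1 p {{prime⇒nonTrivial p-prime}}

coprime⇒∤ : ∀ {z p} → Prime p → Coprime z p → ¬ p ∣ z
coprime⇒∤ p-prime c p∣z = contradiction (c (p∣z , ℕ∣.∣-refl)) (λ p≡1 → <⇒≢ (prime>1 p-prime) (sym p≡1))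

∤⇒coprime : ∀ {z p} → Prime p → ¬ p ∣ z → Coprime z p
∤⇒coprime p-prime p∤z (d∣z , d∣p) with prime⇒irreducible p-prime d∣p
... | inj₁ d≡1 = d≡1
... | inj₂ refl = contradiction d∣z p∤z

coprime-≡-mod : ∀ {u a b} → a ≡ b [mod u ] → Coprime ∣ a ∣ u → Coprime ∣ b ∣ u
coprime-≡-mod {u} {a} {b} (mod p) c {d} (d∣b , d∣u) = c (ℤ∣.∣⇒∣ᵤ d∣a , d∣u)
  where
  d∣a : + d ℤ∣.∣ a
  d∣a = subst (+ d ℤ∣.∣_) (undo a b) (ℤ∣.∣m∣n⇒∣m+n (ℤ∣.∣-trans (ℤ∣.∣ᵤ⇒∣ d∣u) p) (ℤ∣.∣ᵤ⇒∣ {+ d} {b} d∣b))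
    where
    undo : ∀ a b → (a - b) ℤ.+ b ≡ a
    undo = ℤ-Ring.solve-∀

≡-mod-*⇔ : ∀ {u v a b} → Coprime u v → (a ≡ b [mod u * v ]) ⇔ (a ≡ b [mod u ] × a ≡ b [mod v ])
≡-mod-*⇔ {u} {v} c = mk⇔
  (λ a≡b → ≡-mod-weaken (ℕ∣.m∣m*n v) a≡b , ≡-mod-weaken (ℕ∣.n∣m*n u) a≡b)
  (λ { (mod p , mod q) → mod (ℤ∣.∣ᵤ⇒∣ (coprime⇒*-∣ c (ℤ∣.∣⇒∣ᵤ p) (ℤ∣.∣⇒∣ᵤ q))) })

ℕ-inverse-mod : ∀ {A p} → Coprime A p → ∃ λ w → + A ℤ.* w ≡ + 1 [mod p ]
ℕ-inverse-mod {A} {p} c with coprime-Bézout c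
... | Bézout.+- x y eq = + x , mod (divides (+ y) (begin
  + A ℤ.* + x - + 1              ≡⟨ cong (_- + 1) (trans (sym (ℤ.pos-* A x)) (cong +_ (*-comm A x))) ⟩
  + (x * A) - + 1                ≡⟨ cong (λ m → + m - + 1) eq ⟨
  + (1 + y * p) - + 1            ≡⟨ cong (_- + 1) (trans (ℤ.pos-+ 1 (y * p)) (cong (ℤ._+_ (+ 1)) (ℤ.pos-* y p))) ⟩
  (+ 1 ℤ.+ + y ℤ.* + p) - + 1    ≡⟨ cancel (+ y ℤ.* + p) ⟩
  + y ℤ.* + p                    ∎))
  where
  open ≡-Reasoning
  cancel : ∀ z → (+ 1 ℤ.+ z) - + 1 ≡ z
  cancel = ℤ-Ring.solve-∀
... | Bézout.-+ x y eq = - + x , mod (divides (- + y) (begin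
  + A ℤ.* - + x - + 1            ≡⟨ regroup (+ A) (+ x) ⟩
  - (+ 1 ℤ.+ + x ℤ.* + A)        ≡⟨ cong (λ z → - (+ 1 ℤ.+ z)) (ℤ.pos-* x A) ⟨
  - (+ 1 ℤ.+ + (x * A))          ≡⟨ cong -_ (ℤ.pos-+ 1 (x * A)) ⟨
  - + (1 + x * A)                ≡⟨ cong (λ m → - + m) eq ⟩
  - + (y * p)                    ≡⟨ cong -_ (ℤ.pos-* y p) ⟩
  - (+ y ℤ.* + p)                ≡⟨ ℤ.neg-distribˡ-* (+ y) (+ p) ⟩
  - + y ℤ.* + p                  ∎))
  where
  open ≡-Reasoning
  regroup : ∀ a x → a ℤ.* - x - + 1 ≡ - (+ 1 ℤ.+ x ℤ.* a)
  regroup = ℤ-Ring.solve-∀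

inverse-mod : ∀ {a p} → Coprime ∣ a ∣ p → ∃ λ w → a ℤ.* w ≡ + 1 [mod p ]
inverse-mod {+ A}      c = ℕ-inverse-mod c
inverse-mod { -[1+ n ]} c with ℕ-inverse-mod c
... | w , aw≡1 = - w , ≡-mod-trans (≡-mod-reflexive (neg-neg (+ suc n) w)) aw≡1
  where
  neg-neg : ∀ a w → - a ℤ.* - w ≡ a ℤ.* w
  neg-neg = ℤ-Ring.solve-∀

*-cancelˡ-mod : ∀ {p} c {a b} → Coprime ∣ c ∣ p → c ℤ.* a ≡ c ℤ.* b [mod p ] → a ≡ b [mod p ]
*-cancelˡ-mod {p} c {a} {b} c⊥p ca≡cb with inverse-mod {c} c⊥p
... | w , cw≡1 = begin
  a                   ≈⟨ unit a ⟨
  w ℤ.* (c ℤ.* a)      ≈⟨ *-congˡ-mod w ca≡cb ⟩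
  w ℤ.* (c ℤ.* b)      ≈⟨ unit b ⟩
  b                   ∎
  where
  open ≡-mod-Reasoning p
  unit : ∀ z → w ℤ.* (c ℤ.* z) ≡ z [mod p ]
  unit z = begin
    w ℤ.* (c ℤ.* z)    ≡⟨ reassoc w c z ⟩
    (c ℤ.* w) ℤ.* z    ≈⟨ *-congʳ-mod z cw≡1 ⟩
    + 1 ℤ.* z          ≡⟨ ℤ.*-identityˡ z ⟩
    z                 ∎
    where
    reassoc : ∀ w c z → w ℤ.* (c ℤ.* z) ≡ (c ℤ.* w) ℤ.* z
    reassoc = ℤ-Ring.solve-∀

record LinearRoot (p : ℕ) (a c : ℤ) : Set where
  field
    root    : ℕ
    root<p  : root < p
    solves  : ∀ {z} → (a ℤ.* z ≡ c [mod p ]) ⇔ (z ≡ + root [mod p ])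

linear-root : ∀ {p} .{{_ : NonZero p}} a c → Coprime ∣ a ∣ p → LinearRoot p a c
linear-root {p} a c a⊥p with inverse-mod {a} a⊥p
... | w , aw≡1 = record { root = (c ℤ.* w) %ℕ p ; root<p = n%ℕd<d (c ℤ.* w) p ; solves = mk⇔ to from }
  where
  open ≡-mod-Reasoning p
  swap : ∀ a w z → a ℤ.* w ℤ.* z ≡ w ℤ.* (a ℤ.* z)
  swap = ℤ-Ring.solve-∀
  swap′ : ∀ c a w → a ℤ.* (c ℤ.* w) ≡ c ℤ.* (a ℤ.* w)
  swap′ = ℤ-Ring.solve-∀
  to : ∀ {z} → a ℤ.* z ≡ c [mod p ] → z ≡ + ((c ℤ.* w) %ℕ p) [mod p ]
  to {z} az≡c = begin
    z                     ≡⟨ ℤ.*-identityˡ z ⟨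
    + 1 ℤ.* z              ≈⟨ *-congʳ-mod z aw≡1 ⟨
    a ℤ.* w ℤ.* z          ≡⟨ swap a w z ⟩
    w ℤ.* (a ℤ.* z)        ≈⟨ *-congˡ-mod w az≡c ⟩
    w ℤ.* c                ≡⟨ ℤ.*-comm w c ⟩
    c ℤ.* w                ≈⟨ ≡-mod-% (c ℤ.* w) ⟩
    + ((c ℤ.* w) %ℕ p)     ∎
  from : ∀ {z} → z ≡ + ((c ℤ.* w) %ℕ p) [mod p ] → a ℤ.* z ≡ c [mod p ]
  from {z} z≡r = begin
    a ℤ.* z                ≈⟨ *-congˡ-mod a (≡-mod-trans z≡r (≡-mod-sym (≡-mod-% (c ℤ.* w)))) ⟩
    a ℤ.* (c ℤ.* w)        ≡⟨ swap′ c a w ⟩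
    c ℤ.* (a ℤ.* w)        ≈⟨ *-congˡ-mod c aw≡1 ⟩
    c ℤ.* + 1              ≡⟨ ℤ.*-identityʳ c ⟩
    c                      ∎

≡ᵇ-mod-does : ∀ a b u → a ≡ᵇ b [mod u ] ≡ does (a ≡? b [mod u ])
≡ᵇ-mod-does a b u = isYes≗does (u ∣? ∣ a - b ∣)

≡ᵇ-mod-⇔ : ∀ {a b c d u v} → (a ≡ b [mod u ]) ⇔ (c ≡ d [mod v ]) → a ≡ᵇ b [mod u ] ≡ c ≡ᵇ d [mod v ]
≡ᵇ-mod-⇔ {a} {b} {c} {d} {u} {v} eq = begin
  a ≡ᵇ b [mod u ]               ≡⟨ ≡ᵇ-mod-does a b u ⟩
  does (a ≡? b [mod u ])         ≡⟨ does-⇔ eq (a ≡? b [mod u ]) (c ≡? d [mod v ]) ⟩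
  does (c ≡? d [mod v ])         ≡⟨ ≡ᵇ-mod-does c d v ⟨
  c ≡ᵇ d [mod v ]               ∎
  where open ≡-Reasoning

≡ᵇ-mod-diff : ∀ {u} a b c d → a - b ≡ c - d [mod u ] → a ≡ᵇ b [mod u ] ≡ c ≡ᵇ d [mod u ]
≡ᵇ-mod-diff a b c d a-b≡c-d = ≡ᵇ-mod-⇔ {a} {b} {c} {d} (mk⇔ (λ a≡b → -≡0⇒≡-mod (≡-mod-trans (≡-mod-sym a-b≡c-d) (≡-mod⇒-≡0 a≡b)))
                                     (λ c≡d → -≡0⇒≡-mod (≡-mod-trans a-b≡c-d (≡-mod⇒-≡0 c≡d))))

≡ᵇ-mod-* : ∀ {u v} → Coprime u v → ∀ a b → a ≡ᵇ b [mod u * v ] ≡ (a ≡ᵇ b [mod u ]) ∧ (a ≡ᵇ b [mod v ])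
≡ᵇ-mod-* {u} {v} c a b = begin
  a ≡ᵇ b [mod u * v ]                                    ≡⟨ ≡ᵇ-mod-does a b (u * v) ⟩
  does (a ≡? b [mod u * v ])                              ≡⟨ does-⇔ (≡-mod-*⇔ c) (a ≡? b [mod u * v ]) (a ≡? b [mod u ] ×-dec a ≡? b [mod v ]) ⟩
  does (a ≡? b [mod u ]) ∧ does (a ≡? b [mod v ])          ≡⟨ cong₂ _∧_ (≡ᵇ-mod-does a b u) (≡ᵇ-mod-does a b v) ⟨
  (a ≡ᵇ b [mod u ]) ∧ (a ≡ᵇ b [mod v ])                  ∎
  where open ≡-Reasoning

pos-^ : ∀ m k → + (m ^ k) ≡ (+ m) ℤ.^ k
pos-^ m zero    = refl
pos-^ m (suc k) = trans (ℤ.pos-* m (m ^ k)) (cong (ℤ._*_ (+ m)) (pos-^ m k))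

^-distrib-* : ∀ a b k → (a ℤ.* b) ℤ.^ k ≡ a ℤ.^ k ℤ.* b ℤ.^ k
^-distrib-* a b zero    = refl
^-distrib-* a b (suc k) = trans (cong (ℤ._*_ (a ℤ.* b)) (^-distrib-* a b k)) (interchange a b (a ℤ.^ k) (b ℤ.^ k))
  where
  interchange : ∀ a b x y → (a ℤ.* b) ℤ.* (x ℤ.* y) ≡ (a ℤ.* x) ℤ.* (b ℤ.* y)
  interchange = ℤ-Ring.solve-∀

neg-^ : ∀ m k → (- + m) ℤ.^ k ≡ (- + 1) ℤ.^ k ℤ.* + (m ^ k)
neg-^ m k = begin
  (- + m) ℤ.^ k                  ≡⟨ cong (ℤ._^ k) (neg-as-* (+ m)) ⟩
  ((- + 1) ℤ.* + m) ℤ.^ k        ≡⟨ ^-distrib-* (- + 1) (+ m) k ⟩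
  (- + 1) ℤ.^ k ℤ.* (+ m) ℤ.^ k  ≡⟨ cong (ℤ._*_ ((- + 1) ℤ.^ k)) (pos-^ m k) ⟨
  (- + 1) ℤ.^ k ℤ.* + (m ^ k)    ∎
  where
  open ≡-Reasoning
  neg-as-* : ∀ x → - x ≡ (- + 1) ℤ.* x
  neg-as-* = ℤ-Ring.solve-∀

-- Valuations and factorisation into prime powers

p-part : ∀ {p} → 1 < p → ∀ n .{{_ : NonZero n}} → ∃ λ e → ∃ λ m → n ≡ p ^ e * m × ¬ p ∣ m
p-part {p} 1<p n = go n (<-wellFounded n)
  where
  go : ∀ n .{{_ : NonZero n}} → Acc _<_ n → ∃ λ e → ∃ λ m → n ≡ p ^ e * m × ¬ p ∣ m
  go n (acc rec) with p ∣? n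
  ... | no p∤n = 0 , n , sym (+-identityʳ n) , p∤n
  ... | yes (ℕ∣.divides q@(suc _) refl) with go q (rec (m<m*n q p 1<p))
  ...   | e , m , q≡p^e*m , p∤m = suc e , m , step , p∤m
    where
    step : q * p ≡ p * p ^ e * m
    step = trans (cong (_* p) q≡p^e*m) (rotate (p ^ e) m p)
      where
      rotate : ∀ a m p → a * m * p ≡ p * a * m
      rotate = solve-∀

^-∣-^ : ∀ p {m n} → m ≤ n → p ^ m ∣ p ^ n
^-∣-^ p {m} {n} m≤n = ℕ∣.divides (p ^ (n ∸ m)) (trans (cong (p ^_) (sym (m∸n+n≡m m≤n))) (^-distribˡ-+-* p (n ∸ m) m))

n<m^n : ∀ {m} → 1 < m → ∀ n → n < m ^ n
n<m^n 1<m zero    = s≤s z≤n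
n<m^n {m} 1<m (suc n) = begin-strict
  suc n             <⟨ s<s (n<m^n 1<m n) ⟩
  suc (m ^ n)       ≤⟨ +-monoˡ-≤ (m ^ n) (≤-trans (s≤s z≤n) (n<m^n 1<m n)) ⟩
  m ^ n + m ^ n     ≡⟨ cong (_+_ (m ^ n)) (+-identityʳ (m ^ n)) ⟨
  2 * m ^ n         ≤⟨ *-monoˡ-≤ (m ^ n) 1<m ⟩
  m ^ suc n         ∎
  where open ≤-Reasoning

ν-unique : ∀ {p} → 1 < p → ∀ n .{{_ : NonZero n}} e m → n ≡ p ^ e * m → ¬ p ∣ m → ν p n ≡ e
ν-unique {p} 1<p n e m n≡p^e*m p∤m = begin
  ν p n                                  ≡⟨ length-filterᵇ-applyUpTo (λ i → ⌊ p ^ suc i ∣? n ⌋) id n ⟩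
  ∑ n (λ i → χ ⌊ p ^ suc i ∣? n ⌋)         ≡⟨ ∑-cong′ n (λ i → cong χ (⌊⌋-⇔ (mk⇔ (to i) (from i)) (p ^ suc i ∣? n) (i <? e))) ⟩
  ∑ n (λ i → χ ⌊ i <? e ⌋)                 ≡⟨ ∑-< n e≤n ⟩
  e                                      ∎
  where
  open ≡-Reasoning
  instance
    p≢0 : NonZero p
    p≢0 = >-nonZero (<-trans z<s 1<p)
    p^e≢0 : NonZero (p ^ e)
    p^e≢0 = m^n≢0 p e
    m≢0 : NonZero m
    m≢0 = ≢-nonZero (λ { refl → ≢-nonZero⁻¹ n (trans n≡p^e*m (*-zeroʳ (p ^ e))) })
  e≤n : e ≤ n
  e≤n = ≤-trans (<⇒≤ (n<m^n 1<p e)) (≤-trans (m≤m*n (p ^ e) m) (≤-reflexive (sym n≡p^e*m)))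
  to : ∀ i → p ^ suc i ∣ n → i < e
  to i p^[1+i]∣n = ≰⇒> (λ e≤i → p∤m (ℕ∣.*-cancelˡ-∣ (p ^ e)
    (ℕ∣.∣-trans (ℕ∣.∣-trans (ℕ∣.∣-reflexive (*-comm (p ^ e) p)) (^-∣-^ p (s≤s e≤i))) (subst (p ^ suc i ∣_) n≡p^e*m p^[1+i]∣n))))
  from : ∀ i → i < e → p ^ suc i ∣ n
  from i i<e = subst (p ^ suc i ∣_) (sym n≡p^e*m) (ℕ∣.∣m⇒∣m*n m (^-∣-^ p i<e))

distinct-primes⇒coprime : ∀ {p q} → Prime p → Prime q → p ≢ q → ∀ e → Coprime q (p ^ e)
distinct-primes⇒coprime {p} {q} p-prime q-prime p≢q e = coprime-^ e (∤⇒coprime p-prime p∤q)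
  where
  p∤q : ¬ p ∣ q
  p∤q p∣q with prime⇒irreducible q-prime p∣q
  ... | inj₁ refl = contradiction p-prime λ ()
  ... | inj₂ p≡q  = p≢q p≡q

no-prime-divisor⇒≡1 : ∀ n .{{_ : NonZero n}} → (∀ {q} → Prime q → ¬ q ∣ n) → n ≡ 1
no-prime-divisor⇒≡1 n no-divisor with factorise n
... | record { factors = [] ; isFactorisation = n≡1 } = n≡1
... | record { factors = q ∷ qs ; isFactorisation = n≡q*qs ; factorsPrime = q-prime ∷ _ } =
  contradiction (subst (q ∣_) (sym n≡q*qs) (ℕ∣.m∣m*n (product qs))) (no-divisor q-prime)

record PrimeDivisorList (n : ℕ) (L : List ℕ) : Set where
  field
    unique  : Unique L
    members : ∀ {q} → q ∈ L ⇔ (Prime q × q ∣ n)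

PrimeDivisorList-head : ∀ {n p L} → PrimeDivisorList n (p ∷ L) → Prime p
PrimeDivisorList-head P = proj₁ (Equivalence.to (PrimeDivisorList.members P) (here refl))

PrimeDivisorList-head∉ : ∀ {n p L q} → PrimeDivisorList n (p ∷ L) → q ∈ L → p ≢ q
PrimeDivisorList-head∉ P q∈L with PrimeDivisorList.unique P
... | p∉L ∷ _ = All.lookup p∉L q∈L

primeDivisors-list : ∀ n .{{_ : NonZero n}} → PrimeDivisorList n (primeDivisors n)
primeDivisors-list n = record
  { unique  = Unique.filter⁺ (T? ∘ is-prime-divisor) (Unique.upTo⁺ (suc n))
  ; members = mk⇔ to from
  }
  where
  is-prime-divisor : ℕ → Bool
  is-prime-divisor q = ⌊ prime? q ⌋ ∧ ⌊ q ∣? n ⌋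
  to : ∀ {q} → q ∈ primeDivisors n → Prime q × q ∣ n
  to {q} q∈ with Equivalence.to (T-∧ {⌊ prime? q ⌋} {⌊ q ∣? n ⌋}) (proj₂ (∈-filter⁻ (T? ∘ is-prime-divisor) {xs = upTo (suc n)} q∈))
  ... | is-prime , is-divisor = toWitness is-prime , toWitness is-divisor
  from : ∀ {q} → Prime q × q ∣ n → q ∈ primeDivisors n
  from {q} (q-prime , q∣n) = ∈-filter⁺ (T? ∘ is-prime-divisor) (∈-upTo⁺ (s≤s (ℕ∣.∣⇒≤ q∣n)))
                               (Equivalence.from (T-∧ {⌊ prime? q ⌋} {⌊ q ∣? n ⌋}) (fromWitness q-prime , fromWitness q∣n))

ν-cofactor : ∀ {p q n e m} .{{_ : NonZero n}} .{{_ : NonZero m}} → Prime p → Prime q → p ≢ q →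
             n ≡ p ^ e * m → ν q m ≡ ν q n
ν-cofactor {p} {q} {n} {e} {m} p-prime q-prime p≢q n≡p^e*m with p-part (prime>1 q-prime) m
... | f , m′ , m≡q^f*m′ , q∤m′ =
  trans (ν-unique (prime>1 q-prime) m f m′ m≡q^f*m′ q∤m′) (sym (ν-unique (prime>1 q-prime) n f (p ^ e * m′) n≡q^f*[p^e*m′] q∤p^e*m′))
  where
  n≡q^f*[p^e*m′] : n ≡ q ^ f * (p ^ e * m′)
  n≡q^f*[p^e*m′] = trans n≡p^e*m (trans (cong (p ^ e *_) m≡q^f*m′) (x*[y*z]≡y*[x*z] (p ^ e) (q ^ f) m′))
    where
    x*[y*z]≡y*[x*z] : ∀ x y z → x * (y * z) ≡ y * (x * z)
    x*[y*z]≡y*[x*z] = solve-∀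
  q∤p^e*m′ : ¬ q ∣ p ^ e * m′
  q∤p^e*m′ q∣ = q∤m′ (coprime-divisor (distinct-primes⇒coprime p-prime q-prime p≢q e) q∣)

PrimeDivisorList-cofactor : ∀ {p L n e m} → PrimeDivisorList n (p ∷ L) → n ≡ p ^ e * m → ¬ p ∣ m → PrimeDivisorList m L
PrimeDivisorList-cofactor {p} {L} {n} {e} {m} P n≡p^e*m p∤m = record
  { unique  = unique-tail (PrimeDivisorList.unique P)
  ; members = mk⇔ to from
  }
  where
  open PrimeDivisorList P using (members)
  unique-tail : Unique (p ∷ L) → Unique L
  unique-tail (_ ∷ u) = u
  p-prime : Prime p
  p-prime = PrimeDivisorList-head P
  to : ∀ {q} → q ∈ L → Prime q × q ∣ m
  to {q} q∈L with Equivalence.to members (there q∈L)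
  ... | q-prime , q∣n = q-prime , coprime-divisor (distinct-primes⇒coprime p-prime q-prime (PrimeDivisorList-head∉ P q∈L) e) (subst (q ∣_) n≡p^e*m q∣n)
  from : ∀ {q} → Prime q × q ∣ m → q ∈ L
  from {q} (q-prime , q∣m) with Equivalence.from members (q-prime , subst (q ∣_) (sym n≡p^e*m) (ℕ∣.∣n⇒∣m*n (p ^ e) q∣m))
  ... | here refl = contradiction q∣m p∤m
  ... | there q∈L = q∈L

record Multiplicative (F : ℕ → ℕ) : Set where
  field
    F-1 : F 1 ≡ 1
    F-* : ∀ u v .{{_ : NonZero v}} → Coprime u v → F (u * v) ≡ F u * F v

multiplicative-factorisation : ∀ {F} → Multiplicative F → ∀ {L} n .{{_ : NonZero n}} → PrimeDivisorList n L →
                               F n ≡ product (map (λ q → F (q ^ ν q n)) L)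
multiplicative-factorisation {F} mult {[]} n P =
  trans (cong F (no-prime-divisor⇒≡1 n (λ q-prime q∣n → ∉[] (Equivalence.from (PrimeDivisorList.members P) (q-prime , q∣n))))) F-1
  where
  open Multiplicative mult
  ∉[] : ∀ {q} → ¬ q ∈ []
  ∉[] ()
multiplicative-factorisation {F} mult {p ∷ L} n P with p-part (prime>1 (PrimeDivisorList-head P)) n
... | e , m , n≡p^e*m , p∤m = begin
  F n                                                        ≡⟨ cong F n≡p^e*m ⟩
  F (p ^ e * m)                                              ≡⟨ F-* (p ^ e) m (Coprime.sym (coprime-^ e (∤⇒coprime p-prime p∤m))) ⟩
  F (p ^ e) * F m                                            ≡⟨ cong₂ (λ e′ x → F (p ^ e′) * x) (sym (ν-unique (prime>1 p-prime) n e m n≡p^e*m p∤m))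
                                                                  (multiplicative-factorisation mult m (PrimeDivisorList-cofactor {e = e} P n≡p^e*m p∤m)) ⟩
  F (p ^ ν p n) * product (map (λ q → F (q ^ ν q m)) L)      ≡⟨ cong (λ xs → F (p ^ ν p n) * product xs) (map-cong-local (All.tabulate same-ν)) ⟩
  F (p ^ ν p n) * product (map (λ q → F (q ^ ν q n)) L)      ∎
  where
  open ≡-Reasoning
  open Multiplicative mult
  p-prime : Prime p
  p-prime = PrimeDivisorList-head P
  instance
    m≢0 : NonZero m
    m≢0 = ≢-nonZero (λ { refl → ≢-nonZero⁻¹ n (trans n≡p^e*m (*-zeroʳ (p ^ e))) })
  same-ν : ∀ {q} → q ∈ L → F (q ^ ν q m) ≡ F (q ^ ν q n)
  same-ν {q} q∈L = cong (λ v → F (q ^ v)) (ν-cofactor {e = e} {m = m} p-prime q-prime (PrimeDivisorList-head∉ P q∈L) n≡p^e*m)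
    where
    q-prime : Prime q
    q-prime = proj₁ (Equivalence.to (PrimeDivisorList.members P) (there q∈L))

toℚᵘ-/ : ∀ i d → toℚᵘ (i / suc d) ≃ᵘ mkℚᵘ i d
toℚᵘ-/ i d = *≡* (begin
  ↥ᵘ toℚᵘ q ℤ.* + suc d     ≡⟨ cong (ℤ._* + suc d) (ℚ.↥ᵘ-toℚᵘ q) ⟩
  ↥ q ℤ.* + suc d           ≡⟨ cong (ℤ._*_ (↥ q)) (ℚ.↧-/ i (suc d)) ⟨
  ↥ q ℤ.* (↧ q ℤ.* g)       ≡⟨ rearrange (↥ q) (↧ q) g ⟩
  (↥ q ℤ.* g) ℤ.* ↧ q       ≡⟨ cong₂ ℤ._*_ (ℚ.↥-/ i (suc d)) (sym (ℚ.↧ᵘ-toℚᵘ q)) ⟩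
  i ℤ.* ↧ᵘ toℚᵘ q           ∎)
  where
  open ≡-Reasoning
  q : ℚ
  q = i / suc d
  g : ℤ
  g = gcd i (+ suc d)
  rearrange : ∀ a b g → a ℤ.* (b ℤ.* g) ≡ (a ℤ.* g) ℤ.* b
  rearrange = ℤ-Ring.solve-∀

/1-* : ∀ a b → (a / 1) ℚ.* (b / 1) ≡ (a ℤ.* b) / 1
/1-* a b = ℚ.toℚᵘ-injective (ℚᵘ.≃-trans (ℚ.toℚᵘ-homo-* (a / 1) (b / 1))
             (ℚᵘ.≃-trans (ℚᵘ.*-cong (toℚᵘ-/ a 0) (toℚᵘ-/ b 0)) (ℚᵘ.≃-sym (toℚᵘ-/ (a ℤ.* b) 0))))

1/-*-cancel : ∀ d X → ((+ 1) / suc d) ℚ.* ((+ suc d ℤ.* X) / 1) ≡ X / 1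
1/-*-cancel d X = ℚ.toℚᵘ-injective (ℚᵘ.≃-trans (ℚ.toℚᵘ-homo-* ((+ 1) / suc d) ((+ suc d ℤ.* X) / 1))
                    (ℚᵘ.≃-trans (ℚᵘ.*-cong (toℚᵘ-/ (+ 1) d) (toℚᵘ-/ (+ suc d ℤ.* X) 0))
                      (ℚᵘ.≃-trans (*≡* cross) (ℚᵘ.≃-sym (toℚᵘ-/ X 0)))))
  where
  cross : ((+ 1) ℤ.* (+ suc d ℤ.* X)) ℤ.* + 1 ≡ X ℤ.* + suc (d * 1)
  cross = trans (rearrange (+ suc d) X) (cong (λ z → X ℤ.* + suc z) (sym (*-identityʳ d)))
    where
    rearrange : ∀ s x → (+ 1 ℤ.* (s ℤ.* x)) ℤ.* + 1 ≡ x ℤ.* s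
    rearrange = ℤ-Ring.solve-∀

zpow-pred-* : ∀ p .{{_ : NonZero p}} w X → zpow p (+ w - + 1) ℚ.* ((+ p ℤ.* X) / 1) ≡ (+ (p ^ w) ℤ.* X) / 1
zpow-pred-* (suc d) zero X = begin
  ((+ 1) / suc (d * 1)) ℚ.* ((+ suc d ℤ.* X) / 1)   ≡⟨ cong (λ z → ((+ 1) / suc z) ℚ.* ((+ suc d ℤ.* X) / 1)) (*-identityʳ d) ⟩
  ((+ 1) / suc d) ℚ.* ((+ suc d ℤ.* X) / 1)         ≡⟨ 1/-*-cancel d X ⟩
  X / 1                                             ≡⟨ cong (_/ 1) (ℤ.*-identityˡ X) ⟨
  (+ 1 ℤ.* X) / 1                                   ∎
  where open ≡-Reasoning
zpow-pred-* (suc d) (suc w) X = begin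
  (+ (suc d ^ w) / 1) ℚ.* ((+ suc d ℤ.* X) / 1)     ≡⟨ /1-* (+ (suc d ^ w)) (+ suc d ℤ.* X) ⟩
  (+ (suc d ^ w) ℤ.* (+ suc d ℤ.* X)) / 1           ≡⟨ cong (_/ 1) (rearrange (+ (suc d ^ w)) (+ suc d) X) ⟩
  (+ suc d ℤ.* + (suc d ^ w) ℤ.* X) / 1             ≡⟨ cong (λ z → (z ℤ.* X) / 1) (ℤ.pos-* (suc d) (suc d ^ w)) ⟨
  (+ (suc d ^ suc w) ℤ.* X) / 1                     ∎
  where
  open ≡-Reasoning
  rearrange : ∀ a s x → a ℤ.* (s ℤ.* x) ≡ s ℤ.* a ℤ.* x
  rearrange = ℤ-Ring.solve-∀

-- Exunits and the tuple count

module Exunits (a₁ a₂ b₁ b₂ : ℤ) where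

  f : ℤ → ℤ
  f = fpoly a₁ a₂ b₁ b₂

  Exunit : ℕ → ℕ → Set
  Exunit u x = Coprime ∣ f (+ x) ∣ u

  exunit-dec : ∀ u x → Dec (Exunit u x)
  exunit-dec u x = coprime? ∣ f (+ x) ∣ u

  exunit? : ℕ → ℕ → Bool
  exunit? = isExunit a₁ a₂ b₁ b₂

  exunit?-does : ∀ u x → exunit? u x ≡ does (exunit-dec u x)
  exunit?-does u x = trans (isYes≗does gcd≟1)
                            (does-⇔ (mk⇔ (gcd≡1⇒coprime ∘ ℤ.+-injective) (cong +_ ∘ coprime⇒gcd≡1)) gcd≟1 (exunit-dec u x))
    where
    gcd≟1 : Dec (gcd (f (+ x)) (+ u) ≡ + 1)
    gcd≟1 = gcd (f (+ x)) (+ u) ℤ.≟ + 1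

  exunit?-⇔ : ∀ {u v x y} → Exunit u x ⇔ Exunit v y → exunit? u x ≡ exunit? v y
  exunit?-⇔ {u} {v} {x} {y} eq = begin
    exunit? u x                      ≡⟨ exunit?-does u x ⟩
    does (exunit-dec u x)     ≡⟨ does-⇔ eq (exunit-dec u x) (exunit-dec v y) ⟩
    does (exunit-dec v y)     ≡⟨ exunit?-does v y ⟨
    exunit? v y                      ∎
    where open ≡-Reasoning

  exunit?-* : ∀ u v x → exunit? (u * v) x ≡ exunit? u x ∧ exunit? v x
  exunit?-* u v x = begin
    exunit? (u * v) x                                            ≡⟨ exunit?-does (u * v) x ⟩
    does (exunit-dec (u * v) x)                           ≡⟨ does-⇔ coprime-*⇔ (exunit-dec (u * v) x) (exunit-dec u x ×-dec exunit-dec v x) ⟩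
    does (exunit-dec u x) ∧ does (exunit-dec v x) ≡⟨ cong₂ _∧_ (exunit?-does u x) (exunit?-does v x) ⟨
    exunit? u x ∧ exunit? v x                                    ∎
    where open ≡-Reasoning

  f-cong-mod : ∀ {u x y} → x ≡ y [mod u ] → f x ≡ f y [mod u ]
  f-cong-mod x≡y = *-cong-mod (sub-cong-mod (*-congˡ-mod a₁ x≡y) ≡-mod-refl) (sub-cong-mod (*-congˡ-mod b₁ x≡y) ≡-mod-refl)

  exunit?-cong : ∀ u {x y} → + x ≡ + y [mod u ] → exunit? u x ≡ exunit? u y
  exunit?-cong u x≡y = exunit?-⇔ (mk⇔ (coprime-≡-mod (f-cong-mod x≡y)) (coprime-≡-mod (f-cong-mod (≡-mod-sym x≡y))))

  exunit?-^ : ∀ p e x → exunit? (p ^ suc e) x ≡ exunit? p x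
  exunit?-^ p e x = exunit?-⇔ (coprime-^⇔ e)

  count : ℕ → ℕ → ℤ → ℕ
  count u zero    s = χ ((+ 0) ≡ᵇ s [mod u ])
  count u (suc k) s = ∑ u (λ x → χ (exunit? u x) * count u k (s - + x))

  𝒩≡count : ∀ n k s → 𝒩 k a₁ a₂ b₁ b₂ s n ≡ count n k s
  𝒩≡count n zero    s with (+ 0) ≡ᵇ s [mod n ]
  ... | true  = refl
  ... | false = refl
  𝒩≡count n (suc k) s = begin
    length (filterᵇ (Sum≡ s) (concatMap (λ x → map (x ∷_) T) E))   ≡⟨ length-filterᵇ-concatMap (Sum≡ s) _ E ⟩
    sum (map (λ x → length (filterᵇ (Sum≡ s) (map (x ∷_) T))) E)    ≡⟨ cong sum (map-cong first E) ⟩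
    sum (map (λ x → count n k (s - + x)) E)                         ≡⟨ sum-map-filterᵇ-applyUpTo (exunit? n) id n _ ⟩
    count n (suc k) s                                              ∎
    where
    open ≡-Reasoning
    E : List ℕ
    E = exunits a₁ a₂ b₁ b₂ n
    T : List (List ℕ)
    T = tuples k E
    Sum≡ : ℤ → List ℕ → Bool
    Sum≡ t xs = (+ sum xs) ≡ᵇ t [mod n ]
    peel : ∀ x ys → Sum≡ s (x ∷ ys) ≡ Sum≡ (s - + x) ys
    peel x ys = cong (λ z → isYes (n ∣? ∣ z ∣)) (trans (cong (_- s) (ℤ.pos-+ x (sum ys))) (regroup (+ x) (+ sum ys) s))
      where
      regroup : ∀ x y s → (x ℤ.+ y) - s ≡ y - (s - x)
      regroup = ℤ-Ring.solve-∀
    first : ∀ x → length (filterᵇ (Sum≡ s) (map (x ∷_) T)) ≡ count n k (s - + x)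
    first x = begin
      length (filterᵇ (Sum≡ s) (map (x ∷_) T))          ≡⟨ length-filterᵇ-map-∷ (Sum≡ s) x T ⟩
      length (filterᵇ (Sum≡ s ∘ (x ∷_)) T)              ≡⟨ length-filterᵇ-cong (peel x) T ⟩
      length (filterᵇ (Sum≡ (s - + x)) T)               ≡⟨ 𝒩≡count n k (s - + x) ⟩
      count n k (s - + x)                              ∎

  count-cong : ∀ u k {s t} → s ≡ t [mod u ] → count u k s ≡ count u k t
  count-cong u zero    {s} {t} s≡t =
    cong χ (≡ᵇ-mod-⇔ {+ 0} {s} {+ 0} {t} (mk⇔ (λ 0≡s → ≡-mod-trans 0≡s s≡t) (λ 0≡t → ≡-mod-trans 0≡t (≡-mod-sym s≡t))))
  count-cong u (suc k) s≡t =
    ∑-cong′ u (λ x → cong (χ (exunit? u x) *_) (count-cong u k (sub-cong-mod s≡t (≡-mod-refl {a = + x}))))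

  count-summand-periodic : ∀ u k s → Periodic u (λ x → χ (exunit? u x) * count u k (s - + x))
  count-summand-periodic u k s x =
    cong₂ _*_ (cong χ (exunit?-cong u (≡-mod-+-modulus x u)))
              (count-cong u k (sub-cong-mod (≡-mod-refl {a = s}) (≡-mod-+-modulus x u)))

  count-* : ∀ u v .{{_ : NonZero v}} → Coprime u v → ∀ k s → count (u * v) k s ≡ count u k s * count v k s
  count-* u v c zero    s = trans (cong χ (≡ᵇ-mod-* c (+ 0) s)) (χ-∧ ((+ 0) ≡ᵇ s [mod u ]) ((+ 0) ≡ᵇ s [mod v ]))
  count-* u v c (suc k) s = begin
    ∑ (u * v) (λ x → χ (exunit? (u * v) x) * count (u * v) k (s - + x))
      ≡⟨ ∑-cong′ (u * v) (λ x → cong₂ _*_ (trans (cong χ (exunit?-* u v x)) (χ-∧ (exunit? u x) (exunit? v x))) (count-* u v c k (s - + x))) ⟩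
    ∑ (u * v) (λ x → (χ (exunit? u x) * χ (exunit? v x)) * (count u k (s - + x) * count v k (s - + x)))
      ≡⟨ ∑-cong′ (u * v) (λ x → *-*-comm (χ (exunit? u x)) (χ (exunit? v x)) (count u k (s - + x)) (count v k (s - + x))) ⟩
    ∑ (u * v) (λ x → (χ (exunit? u x) * count u k (s - + x)) * (χ (exunit? v x) * count v k (s - + x)))
      ≡⟨ ∑-*-coprime u v c (count-summand-periodic u k s) (count-summand-periodic v k s) ⟩
    count u (suc k) s * count v (suc k) s
      ∎
    where
    open ≡-Reasoning
    *-*-comm : ∀ a b c d → (a * b) * (c * d) ≡ (a * c) * (b * d)
    *-*-comm = solve-∀

  count-mod-1 : ∀ k s → count 1 k s ≡ 1
  count-mod-1 zero    s = cong χ (trans (≡ᵇ-mod-does (+ 0) s 1) (dec-true ((+ 0) ≡? s [mod 1 ]) (mod (ℤ∣.∣ᵤ⇒∣ (ℕ∣.1∣ _)))))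
  count-mod-1 (suc k) s = begin
    χ (exunit? 1 0) * count 1 k (s - + 0) + 0   ≡⟨ +-identityʳ _ ⟩
    χ (exunit? 1 0) * count 1 k (s - + 0)       ≡⟨ cong₂ (λ b c → χ b * c) (trans (exunit?-does 1 0) (dec-true (exunit-dec 1 0) unit))
                                                                          (count-mod-1 k (s - + 0)) ⟩
    1                                          ∎
    where
    open ≡-Reasoning
    unit : Exunit 1 0
    unit (_ , d∣1) = ℕ∣.∣1⇒≡1 d∣1

  count₀-picks-residue : ∀ u .{{_ : NonZero u}} (g : ℕ → ℕ) s → ∑ u (λ x → g x * count u 0 (s - + x)) ≡ g (s %ℕ u)
  count₀-picks-residue u g s = begin
    ∑ u (λ x → g x * count u 0 (s - + x))               ≡⟨ ∑-cong u (λ x<u → trans (*-comm (g _) _) (cong (λ b → χ b * g _) (hits x<u))) ⟩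
    ∑ u (λ x → χ ⌊ x ≟ s %ℕ u ⌋ * g x)             ≡⟨ ∑-indicator u (n%ℕd<d s u) g ⟩
    g (s %ℕ u)                                          ∎
    where
    open ≡-Reasoning
    hits : ∀ {x} → x < u → (+ 0) ≡ᵇ s - + x [mod u ] ≡ ⌊ x ≟ s %ℕ u ⌋
    hits {x} x<u = begin
      (+ 0) ≡ᵇ s - + x [mod u ]          ≡⟨ ≡ᵇ-mod-does (+ 0) (s - + x) u ⟩
      does ((+ 0) ≡? s - + x [mod u ])    ≡⟨ does-⇔ (mk⇔ to from) ((+ 0) ≡? s - + x [mod u ]) (x ≟ s %ℕ u) ⟩
      does (x ≟ s %ℕ u)                   ≡⟨ isYes≗does (x ≟ s %ℕ u) ⟨
      ⌊ x ≟ s %ℕ u ⌋                      ∎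
      where
      to : + 0 ≡ s - + x [mod u ] → x ≡ s %ℕ u
      to 0≡s-x = residue-unique x<u (n%ℕd<d s u) (≡-mod-trans (Equivalence.to 0≡s-x⇔x≡s 0≡s-x) (≡-mod-% s))
      from : x ≡ s %ℕ u → + 0 ≡ s - + x [mod u ]
      from refl = Equivalence.from 0≡s-x⇔x≡s (≡-mod-sym (≡-mod-% s))

  count-1-tuple : ∀ u .{{_ : NonZero u}} s → count u 1 s ≡ χ (exunit? u (s %ℕ u))
  count-1-tuple u s = count₀-picks-residue u (χ ∘ exunit? u) s

  -- The exunits mod p^(e+1) are the lifts of those mod p, so each of the k free coordinates contributes p^e lifts.
  count-^ : ∀ p .{{_ : NonZero p}} e k s → count (p ^ suc e) (suc k) s ≡ p ^ (k * e) * count p (suc k) s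
  count-^ p e zero    s = begin
    count (p ^ suc e) 1 s                     ≡⟨ count-1-tuple (p ^ suc e) s ⟩
    χ (exunit? (p ^ suc e) (s %ℕ p ^ suc e))  ≡⟨ cong χ (trans (exunit?-^ p e _) (exunit?-cong p reduce)) ⟩
    χ (exunit? p (s %ℕ p))                    ≡⟨ count-1-tuple p s ⟨
    count p 1 s                               ≡⟨ +-identityʳ _ ⟨
    1 * count p 1 s                           ∎
    where
    open ≡-Reasoning
    instance
      p^[1+e]≢0 : NonZero (p ^ suc e)
      p^[1+e]≢0 = m^n≢0 p (suc e)
    reduce : + (s %ℕ p ^ suc e) ≡ + (s %ℕ p) [mod p ]
    reduce = ≡-mod-trans (≡-mod-sym (≡-mod-weaken (ℕ∣.m∣m*n (p ^ e)) (≡-mod-% s))) (≡-mod-% s)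
  count-^ p e (suc k) s = begin
    ∑ P (λ x → χ (exunit? P x) * count P (suc k) (s - + x))
      ≡⟨ ∑-cong′ P (λ x → cong₂ _*_ (cong χ (exunit?-^ p e x)) (count-^ p e k (s - + x))) ⟩
    ∑ P (λ x → χ (exunit? p x) * (p ^ (k * e) * count p (suc k) (s - + x)))
      ≡⟨ ∑-cong′ P (λ x → x*[y*z]≡y*[x*z] (χ (exunit? p x)) (p ^ (k * e)) _) ⟩
    ∑ P (λ x → p ^ (k * e) * H x)
      ≡⟨ ∑-*ˡ P (p ^ (k * e)) H ⟩
    p ^ (k * e) * ∑ (p * p ^ e) H
      ≡⟨ cong (λ m → p ^ (k * e) * ∑ m H) (*-comm p (p ^ e)) ⟩
    p ^ (k * e) * ∑ (p ^ e * p) H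
      ≡⟨ cong (p ^ (k * e) *_) (∑-periodic-* (p ^ e) p (count-summand-periodic p (suc k) s)) ⟩
    p ^ (k * e) * (p ^ e * ∑ p H)
      ≡⟨ *-assoc (p ^ (k * e)) (p ^ e) _ ⟨
    (p ^ (k * e) * p ^ e) * ∑ p H
      ≡⟨ cong (_* ∑ p H) (trans (cong (p ^_) (+-comm e (k * e))) (^-distribˡ-+-* p (k * e) e)) ⟨
    p ^ (suc k * e) * count p (suc (suc k)) s
      ∎
    where
    open ≡-Reasoning
    P : ℕ
    P = p ^ suc e
    H : ℕ → ℕ
    H x = χ (exunit? p x) * count p (suc k) (s - + x)
    x*[y*z]≡y*[x*z] : ∀ x y z → x * (y * z) ≡ y * (x * z)
    x*[y*z]≡y*[x*z] = solve-∀

  module ModuloPrime (p : ℕ) (p-prime : Prime p) (a₁⊥p : Coprime ∣ a₁ ∣ p) (b₁⊥p : Coprime ∣ b₁ ∣ p)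
                  (Δ⊥p : Coprime ∣ a₁ ℤ.* b₂ - a₂ ℤ.* b₁ ∣ p) where

    instance
      p≢0 : NonZero p
      p≢0 = prime⇒nonZero p-prime

    R₁ : LinearRoot p a₁ a₂
    R₁ = linear-root a₁ a₂ a₁⊥p

    R₂ : LinearRoot p b₁ b₂
    R₂ = linear-root b₁ b₂ b₁⊥p

    r₁ r₂ : ℕ
    r₁ = LinearRoot.root R₁
    r₂ = LinearRoot.root R₂

    a₁r₁≡a₂ : a₁ ℤ.* + r₁ ≡ a₂ [mod p ]
    a₁r₁≡a₂ = Equivalence.from (LinearRoot.solves R₁) ≡-mod-refl

    b₁r₂≡b₂ : b₁ ℤ.* + r₂ ≡ b₂ [mod p ]
    b₁r₂≡b₂ = Equivalence.from (LinearRoot.solves R₂) ≡-mod-refl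

    r₁≢r₂ : r₁ ≢ r₂
    r₁≢r₂ r₁≡r₂ = coprime⇒∤ p-prime Δ⊥p (Equivalence.to ≡0-mod⇔∣ Δ≡0)
      where
      open ≡-mod-Reasoning p
      cross : ∀ a b r → a ℤ.* (b ℤ.* r) - (a ℤ.* r) ℤ.* b ≡ + 0
      cross = ℤ-Ring.solve-∀
      Δ≡0 : a₁ ℤ.* b₂ - a₂ ℤ.* b₁ ≡ + 0 [mod p ]
      Δ≡0 = begin
        a₁ ℤ.* b₂ - a₂ ℤ.* b₁                        ≈⟨ sub-cong-mod (*-congˡ-mod a₁ (subst (λ r → b₁ ℤ.* + r ≡ b₂ [mod p ]) (sym r₁≡r₂) b₁r₂≡b₂))
                                                                      (*-congʳ-mod b₁ a₁r₁≡a₂) ⟨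
        a₁ ℤ.* (b₁ ℤ.* + r₁) - (a₁ ℤ.* + r₁) ℤ.* b₁  ≡⟨ cross a₁ b₁ (+ r₁) ⟩
        + 0                                         ∎

    root⇒exunit?≡false : ∀ {y} → (a₁ ℤ.* + y ≡ a₂ [mod p ]) ⊎ (b₁ ℤ.* + y ≡ b₂ [mod p ]) → exunit? p y ≡ false
    root⇒exunit?≡false {y} root = trans (exunit?-does p y) (dec-false (exunit-dec p y) (λ unit → coprime⇒∤ p-prime unit (Equivalence.to ≡0-mod⇔∣ f≡0)))
      where
      factor≡0 : (a₁ ℤ.* + y ≡ a₂ [mod p ]) ⊎ (b₁ ℤ.* + y ≡ b₂ [mod p ]) → f (+ y) ≡ + 0 [mod p ]
      factor≡0 (inj₁ a≡) = ≡-mod-trans (*-congʳ-mod (b₁ ℤ.* + y - b₂) (≡-mod⇒-≡0 a≡)) (≡-mod-reflexive (ℤ.*-zeroˡ (b₁ ℤ.* + y - b₂)))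
      factor≡0 (inj₂ b≡) = ≡-mod-trans (*-congˡ-mod (a₁ ℤ.* + y - a₂) (≡-mod⇒-≡0 b≡)) (≡-mod-reflexive (ℤ.*-zeroʳ (a₁ ℤ.* + y - a₂)))
      f≡0 : f (+ y) ≡ + 0 [mod p ]
      f≡0 = factor≡0 root

    root-unique : ∀ {a c y} (R : LinearRoot p a c) → y < p → a ℤ.* + y ≡ c [mod p ] → y ≡ LinearRoot.root R
    root-unique R y<p ay≡c = residue-unique y<p (LinearRoot.root<p R) (Equivalence.to (LinearRoot.solves R) ay≡c)

    non-root⇒exunit : ∀ {y} → y < p → y ≢ r₁ → y ≢ r₂ → Exunit p y
    non-root⇒exunit {y} y<p y≢r₁ y≢r₂ = ∤⇒coprime p-prime p∤f
      where
      p∤f : ¬ p ∣ ∣ f (+ y) ∣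
      p∤f p∣f with euclidsLemma ∣ a₁ ℤ.* + y - a₂ ∣ ∣ b₁ ℤ.* + y - b₂ ∣ p-prime
                     (subst (p ∣_) (ℤ.abs-* (a₁ ℤ.* + y - a₂) (b₁ ℤ.* + y - b₂)) p∣f)
      ... | inj₁ p∣a = y≢r₁ (root-unique R₁ y<p (-≡0⇒≡-mod (Equivalence.from ≡0-mod⇔∣ p∣a)))
      ... | inj₂ p∣b = y≢r₂ (root-unique R₂ y<p (-≡0⇒≡-mod (Equivalence.from ≡0-mod⇔∣ p∣b)))

    exunit?-partition : ∀ {y} → y < p → χ (exunit? p y) + χ ⌊ y ≟ r₁ ⌋ + χ ⌊ y ≟ r₂ ⌋ ≡ 1
    exunit?-partition {y} y<p with y ≟ r₁ | y ≟ r₂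
    ... | yes refl | yes y≡r₂ = contradiction y≡r₂ r₁≢r₂
    ... | yes refl | no  _    = cong (λ b → χ b + 1 + 0) (root⇒exunit?≡false (inj₁ a₁r₁≡a₂))
    ... | no  _    | yes refl = cong (λ b → χ b + 0 + 1) (root⇒exunit?≡false (inj₂ b₁r₂≡b₂))
    ... | no  y≢r₁ | no  y≢r₂ = cong (λ b → χ b + 0 + 0) (trans (exunit?-does p y) (dec-true (exunit-dec p y) (non-root⇒exunit y<p y≢r₁ y≢r₂)))

    ∑-exunits : ∀ (g : ℕ → ℕ) → ∑ p (λ y → χ (exunit? p y) * g y) + g r₁ + g r₂ ≡ ∑ p g
    ∑-exunits g = sym (begin
      ∑ p g
        ≡⟨ ∑-cong p (λ {y} y<p → trans (sym (*-identityˡ (g y))) (cong (_* g y) (sym (exunit?-partition y<p)))) ⟩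
      ∑ p (λ y → (χ (exunit? p y) + χ ⌊ y ≟ r₁ ⌋ + χ ⌊ y ≟ r₂ ⌋) * g y)
        ≡⟨ ∑-cong′ p (λ y → distrib (χ (exunit? p y)) (χ ⌊ y ≟ r₁ ⌋) (χ ⌊ y ≟ r₂ ⌋) (g y)) ⟩
      ∑ p (λ y → χ (exunit? p y) * g y + χ ⌊ y ≟ r₁ ⌋ * g y + χ ⌊ y ≟ r₂ ⌋ * g y)
        ≡⟨ trans (∑-distrib-+ p _ _) (cong (_+ ∑ p (λ y → χ ⌊ y ≟ r₂ ⌋ * g y)) (∑-distrib-+ p _ _)) ⟩
      ∑ p (λ y → χ (exunit? p y) * g y) + ∑ p (λ y → χ ⌊ y ≟ r₁ ⌋ * g y) + ∑ p (λ y → χ ⌊ y ≟ r₂ ⌋ * g y)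
        ≡⟨ cong₂ (λ a b → ∑ p (λ y → χ (exunit? p y) * g y) + a + b)
                 (∑-indicator p (LinearRoot.root<p R₁) g) (∑-indicator p (LinearRoot.root<p R₂) g) ⟩
      ∑ p (λ y → χ (exunit? p y) * g y) + g r₁ + g r₂ ∎)
      where
      open ≡-Reasoning
      distrib : ∀ a b c x → (a + b + c) * x ≡ a * x + b * x + c * x
      distrib = solve-∀

    #exunits : ∑ p (χ ∘ exunit? p) ≡ p ∸ 2
    #exunits = begin
      ∑ p (χ ∘ exunit? p)                                ≡⟨ m+n∸n≡m _ 2 ⟨
      ∑ p (χ ∘ exunit? p) + 2 ∸ 2                        ≡⟨ cong (_∸ 2) (+-assoc (∑ p (χ ∘ exunit? p)) 1 1) ⟨
      ∑ p (χ ∘ exunit? p) + 1 + 1 ∸ 2                    ≡⟨ cong (λ z → z + 1 + 1 ∸ 2) (∑-cong′ p (λ y → *-identityʳ (χ (exunit? p y)))) ⟨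
      ∑ p (λ y → χ (exunit? p y) * 1) + 1 + 1 ∸ 2        ≡⟨ cong (_∸ 2) (∑-exunits (λ _ → 1)) ⟩
      ∑ p (λ _ → 1) ∸ 2                                  ≡⟨ cong (_∸ 2) (trans (∑-const p 1) (*-identityʳ p)) ⟩
      p ∸ 2                                              ∎
      where open ≡-Reasoning

    ∑-count-targets : ∀ k t → ∑ p (λ y → count p k (t - + y)) ≡ (p ∸ 2) ^ k
    ∑-count-targets zero    t = trans (∑-cong′ p (λ y → sym (+-identityʳ (count p 0 (t - + y))))) (count₀-picks-residue p (λ _ → 1) t)
    ∑-count-targets (suc k) t = begin
      ∑ p (λ y → ∑ p (λ x → χ (exunit? p x) * count p k (t - + y - + x)))
        ≡⟨ ∑-comm p p _ ⟩
      ∑ p (λ x → ∑ p (λ y → χ (exunit? p x) * count p k (t - + y - + x)))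
        ≡⟨ ∑-cong′ p (λ x → ∑-*ˡ p (χ (exunit? p x)) _) ⟩
      ∑ p (λ x → χ (exunit? p x) * ∑ p (λ y → count p k (t - + y - + x)))
        ≡⟨ ∑-cong′ p (λ x → cong (χ (exunit? p x) *_) (trans (∑-cong′ p (λ y → cong (count p k) (swap t (+ y) (+ x))))
                                                              (∑-count-targets k (t - + x)))) ⟩
      ∑ p (λ x → χ (exunit? p x) * (p ∸ 2) ^ k)
        ≡⟨ ∑-*ʳ p _ (χ ∘ exunit? p) ⟩
      ∑ p (χ ∘ exunit? p) * (p ∸ 2) ^ k
        ≡⟨ cong (_* (p ∸ 2) ^ k) #exunits ⟩
      (p ∸ 2) ^ suc k ∎
      where
      open ≡-Reasoning
      swap : ∀ t y x → t - y - x ≡ t - x - y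
      swap = ℤ-Ring.solve-∀

    -- Every residue mod p is an exunit or one of r₁, r₂, and the last coordinate ranges over all of them.
    count-recurrence : ∀ k s → count p (suc k) s + count p k (s - + r₁) + count p k (s - + r₂) ≡ (p ∸ 2) ^ k
    count-recurrence k s = trans (∑-exunits (λ y → count p k (s - + y))) (∑-count-targets k s)

    D : ℤ
    D = a₂ ℤ.* b₁ - a₁ ℤ.* b₂

    Y : ℕ → ℤ → ℤ
    Y k s = a₁ ℤ.* b₁ ℤ.* s - a₁ ℤ.* b₂ ℤ.* + k

    admissible? : ℕ → ℤ → ℕ → Bool
    admissible? k s j = (D ℤ.* + j) ≡ᵇ Y k s [mod p ]

    binomSumℕ : ℕ → ℤ → ℕ
    binomSumℕ k s = ∑ (suc k) (λ j → χ (admissible? k s j) * (k C j))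

    binomSum≡binomSumℕ : ∀ k s → binomSum k a₁ a₂ b₁ b₂ s p ≡ + binomSumℕ k s
    binomSum≡binomSumℕ k s = trans (sumℤ-map-pos (k C_) (filterᵇ (admissible? k s) (upTo (suc k))))
                                   (cong +_ (sum-map-filterᵇ-applyUpTo (admissible? k s) id (suc k) (k C_)))

    admissible?-suc : ∀ k s j → admissible? (suc k) s j ≡ admissible? k (s - + r₂) j
    admissible?-suc k s j = ≡ᵇ-mod-diff (D ℤ.* + j) (Y (suc k) s) (D ℤ.* + j) (Y k (s - + r₂)) (begin
      D ℤ.* + j - Y (suc k) s                                        ≡⟨ cong (λ z → D ℤ.* + j - (a₁ ℤ.* b₁ ℤ.* s - a₁ ℤ.* b₂ ℤ.* z)) (ℤ.pos-+ 1 k) ⟩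
      D ℤ.* + j - (a₁ ℤ.* b₁ ℤ.* s - a₁ ℤ.* b₂ ℤ.* (+ 1 ℤ.+ + k))     ≡⟨ peel a₁ a₂ b₁ b₂ s (+ j) (+ k) (+ r₂) ⟩
      D ℤ.* + j - Y k (s - + r₂) - a₁ ℤ.* (b₁ ℤ.* + r₂ - b₂)          ≈⟨ sub-congˡ-mod (D ℤ.* + j - Y k (s - + r₂)) (*-congˡ-mod a₁ (≡-mod⇒-≡0 b₁r₂≡b₂)) ⟩
      D ℤ.* + j - Y k (s - + r₂) - a₁ ℤ.* + 0                         ≡⟨ drop-zero (D ℤ.* + j - Y k (s - + r₂)) a₁ ⟩
      D ℤ.* + j - Y k (s - + r₂)                                      ∎)
      where
      open ≡-mod-Reasoning p
      peel : ∀ a₁ a₂ b₁ b₂ s j k r →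
             (a₂ ℤ.* b₁ - a₁ ℤ.* b₂) ℤ.* j - (a₁ ℤ.* b₁ ℤ.* s - a₁ ℤ.* b₂ ℤ.* (+ 1 ℤ.+ k))
             ≡ (a₂ ℤ.* b₁ - a₁ ℤ.* b₂) ℤ.* j - (a₁ ℤ.* b₁ ℤ.* (s - r) - a₁ ℤ.* b₂ ℤ.* k) - a₁ ℤ.* (b₁ ℤ.* r - b₂)
      peel = ℤ-Ring.solve-∀
      drop-zero : ∀ x a → x - a ℤ.* + 0 ≡ x
      drop-zero = ℤ-Ring.solve-∀

    admissible?-suc-suc : ∀ k s j → admissible? (suc k) s (suc j) ≡ admissible? k (s - + r₁) j
    admissible?-suc-suc k s j = ≡ᵇ-mod-diff (D ℤ.* + suc j) (Y (suc k) s) (D ℤ.* + j) (Y k (s - + r₁)) (begin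
      D ℤ.* + suc j - Y (suc k) s                                    ≡⟨ cong₂ (λ y z → D ℤ.* y - (a₁ ℤ.* b₁ ℤ.* s - a₁ ℤ.* b₂ ℤ.* z)) (ℤ.pos-+ 1 j) (ℤ.pos-+ 1 k) ⟩
      D ℤ.* (+ 1 ℤ.+ + j) - (a₁ ℤ.* b₁ ℤ.* s - a₁ ℤ.* b₂ ℤ.* (+ 1 ℤ.+ + k))
                                                                    ≡⟨ peel a₁ a₂ b₁ b₂ s (+ j) (+ k) (+ r₁) ⟩
      D ℤ.* + j - Y k (s - + r₁) - b₁ ℤ.* (a₁ ℤ.* + r₁ - a₂)          ≈⟨ sub-congˡ-mod (D ℤ.* + j - Y k (s - + r₁)) (*-congˡ-mod b₁ (≡-mod⇒-≡0 a₁r₁≡a₂)) ⟩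
      D ℤ.* + j - Y k (s - + r₁) - b₁ ℤ.* + 0                         ≡⟨ drop-zero (D ℤ.* + j - Y k (s - + r₁)) b₁ ⟩
      D ℤ.* + j - Y k (s - + r₁)                                      ∎)
      where
      open ≡-mod-Reasoning p
      peel : ∀ a₁ a₂ b₁ b₂ s j k r →
             (a₂ ℤ.* b₁ - a₁ ℤ.* b₂) ℤ.* (+ 1 ℤ.+ j) - (a₁ ℤ.* b₁ ℤ.* s - a₁ ℤ.* b₂ ℤ.* (+ 1 ℤ.+ k))
             ≡ (a₂ ℤ.* b₁ - a₁ ℤ.* b₂) ℤ.* j - (a₁ ℤ.* b₁ ℤ.* (s - r) - a₁ ℤ.* b₂ ℤ.* k) - b₁ ℤ.* (a₁ ℤ.* r - a₂)
      peel = ℤ-Ring.solve-∀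
      drop-zero : ∀ x a → x - a ℤ.* + 0 ≡ x
      drop-zero = ℤ-Ring.solve-∀

    admissible?-zero : ∀ s → admissible? 0 s 0 ≡ (+ 0) ≡ᵇ s [mod p ]
    admissible?-zero s = ≡ᵇ-mod-⇔ {D ℤ.* + 0} {Y 0 s} {+ 0} {s} (mk⇔ to from)
      where
      a₁b₁⊥p : Coprime ∣ a₁ ℤ.* b₁ ∣ p
      a₁b₁⊥p = subst (λ z → Coprime z p) (sym (ℤ.abs-* a₁ b₁)) (Coprime.sym (coprime-* (Coprime.sym a₁⊥p) (Coprime.sym b₁⊥p)))
      D0≡ : D ℤ.* + 0 ≡ a₁ ℤ.* b₁ ℤ.* + 0
      D0≡ = trans (ℤ.*-zeroʳ D) (sym (ℤ.*-zeroʳ (a₁ ℤ.* b₁)))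
      Y0≡ : Y 0 s ≡ a₁ ℤ.* b₁ ℤ.* s
      Y0≡ = trans (cong (λ z → a₁ ℤ.* b₁ ℤ.* s - z) (ℤ.*-zeroʳ (a₁ ℤ.* b₂))) (ℤ.+-identityʳ _)
      to : D ℤ.* + 0 ≡ Y 0 s [mod p ] → + 0 ≡ s [mod p ]
      to D0≡Y0 = *-cancelˡ-mod (a₁ ℤ.* b₁) a₁b₁⊥p (subst₂ (λ x y → x ≡ y [mod p ]) D0≡ Y0≡ D0≡Y0)
      from : + 0 ≡ s [mod p ] → D ℤ.* + 0 ≡ Y 0 s [mod p ]
      from 0≡s = subst₂ (λ x y → x ≡ y [mod p ]) (sym D0≡) (sym Y0≡) (*-congˡ-mod (a₁ ℤ.* b₁) 0≡s)

    binomSumℕ-zero : ∀ s → binomSumℕ 0 s ≡ count p 0 s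
    binomSumℕ-zero s = trans (+-identityʳ _) (trans (*-identityʳ _) (cong χ (admissible?-zero s)))

    -- Pascal's rule: shifting j by one corresponds to shifting the target by r₁, keeping j to shifting it by r₂.
    binomSumℕ-recurrence : ∀ k s → binomSumℕ (suc k) s ≡ binomSumℕ k (s - + r₁) + binomSumℕ k (s - + r₂)
    binomSumℕ-recurrence k s = trans (∑-pascal k (χ ∘ admissible? (suc k) s))
      (cong₂ _+_ (∑-cong′ (suc k) (λ j → cong (λ b → χ b * (k C j)) (admissible?-suc-suc k s j)))
                 (∑-cong′ (suc k) (λ j → cong (λ b → χ b * (k C j)) (admissible?-suc k s j))))

    σ : ℕ → ℤ
    σ k = (- + 1) ℤ.^ k

    2-p^ : ∀ k → (+ 2 - + p) ℤ.^ k ≡ σ k ℤ.* + ((p ∸ 2) ^ k)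
    2-p^ k = trans (cong (ℤ._^ k) 2-p≡-[p∸2]) (neg-^ (p ∸ 2) k)
      where
      2-p≡-[p∸2] : + 2 - + p ≡ - + (p ∸ 2)
      2-p≡-[p∸2] = begin
        + 2 - + p                 ≡⟨ cong (λ m → + 2 - + m) (m+[n∸m]≡n (prime>1 p-prime)) ⟨
        + 2 - + (2 + (p ∸ 2))     ≡⟨ cong (λ z → + 2 - z) (ℤ.pos-+ 2 (p ∸ 2)) ⟩
        + 2 - (+ 2 ℤ.+ + (p ∸ 2)) ≡⟨ cancel (+ 2) (+ (p ∸ 2)) ⟩
        - + (p ∸ 2)               ∎
        where
        open ≡-Reasoning
        cancel : ∀ a x → a - (a ℤ.+ x) ≡ - x
        cancel = ℤ-Ring.solve-∀

    Φ : ℕ → ℤ → ℤ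
    Φ k s = + p ℤ.* + binomSumℕ k s ℤ.+ (+ 2 - + p) ℤ.^ k - (+ 2) ℤ.^ k

    count-recurrenceℤ : ∀ k s → + ((p ∸ 2) ^ k) - + count p k (s - + r₁) - + count p k (s - + r₂) ≡ + count p (suc k) s
    count-recurrenceℤ k s = begin
      + Q - + c₁ - + c₂                     ≡⟨ cong (λ z → z - + c₁ - + c₂) (cong +_ (count-recurrence k s)) ⟨
      + (c + c₁ + c₂) - + c₁ - + c₂         ≡⟨ cong (λ z → z - + c₁ - + c₂) (trans (ℤ.pos-+ (c + c₁) c₂) (cong (ℤ._+ + c₂) (ℤ.pos-+ c c₁))) ⟩
      + c ℤ.+ + c₁ ℤ.+ + c₂ - + c₁ - + c₂   ≡⟨ cancel (+ c) (+ c₁) (+ c₂) ⟩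
      + c                                   ∎
      where
      open ≡-Reasoning
      Q c c₁ c₂ : ℕ
      Q = (p ∸ 2) ^ k
      c = count p (suc k) s
      c₁ = count p k (s - + r₁)
      c₂ = count p k (s - + r₂)
      cancel : ∀ a b c → a ℤ.+ b ℤ.+ c - b - c ≡ a
      cancel = ℤ-Ring.solve-∀

    Φ-closed : ∀ k s → Φ k s ≡ σ k ℤ.* (+ p ℤ.* + count p k s)
    Φ-closed zero    s = begin
      + p ℤ.* + binomSumℕ 0 s ℤ.+ + 1 - + 1          ≡⟨ cancel (+ p ℤ.* + binomSumℕ 0 s) ⟩
      + 1 ℤ.* (+ p ℤ.* + binomSumℕ 0 s)              ≡⟨ cong (λ m → + 1 ℤ.* (+ p ℤ.* + m)) (binomSumℕ-zero s) ⟩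
      + 1 ℤ.* (+ p ℤ.* + count p 0 s)                ∎
      where
      open ≡-Reasoning
      cancel : ∀ x → x ℤ.+ + 1 - + 1 ≡ + 1 ℤ.* x
      cancel = ℤ-Ring.solve-∀
    Φ-closed (suc k) s = begin
      + p ℤ.* + binomSumℕ (suc k) s ℤ.+ (+ 2 - + p) ℤ.* W - + 2 ℤ.* T
        ≡⟨ cong (λ z → + p ℤ.* z ℤ.+ (+ 2 - + p) ℤ.* W - + 2 ℤ.* T) (trans (cong +_ (binomSumℕ-recurrence k s)) (ℤ.pos-+ B₁ B₂)) ⟩
      + p ℤ.* (+ B₁ ℤ.+ + B₂) ℤ.+ (+ 2 - + p) ℤ.* W - + 2 ℤ.* T
        ≡⟨ split (+ p) (+ B₁) (+ B₂) W T ⟩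
      Φ k s₁ ℤ.+ Φ k s₂ - + p ℤ.* W
        ≡⟨ cong₂ (λ x y → x ℤ.+ y - + p ℤ.* W) (Φ-closed k s₁) (Φ-closed k s₂) ⟩
      σ k ℤ.* (+ p ℤ.* + c₁) ℤ.+ σ k ℤ.* (+ p ℤ.* + c₂) - + p ℤ.* W
        ≡⟨ cong (λ w → σ k ℤ.* (+ p ℤ.* + c₁) ℤ.+ σ k ℤ.* (+ p ℤ.* + c₂) - + p ℤ.* w) (2-p^ k) ⟩
      σ k ℤ.* (+ p ℤ.* + c₁) ℤ.+ σ k ℤ.* (+ p ℤ.* + c₂) - + p ℤ.* (σ k ℤ.* + Q)
        ≡⟨ collect (σ k) (+ p) (+ c₁) (+ c₂) (+ Q) ⟩
      σ (suc k) ℤ.* (+ p ℤ.* (+ Q - + c₁ - + c₂))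
        ≡⟨ cong (λ z → σ (suc k) ℤ.* (+ p ℤ.* z)) (count-recurrenceℤ k s) ⟩
      σ (suc k) ℤ.* (+ p ℤ.* + count p (suc k) s) ∎
      where
      open ≡-Reasoning
      s₁ s₂ : ℤ
      s₁ = s - + r₁
      s₂ = s - + r₂
      B₁ B₂ c₁ c₂ Q : ℕ
      B₁ = binomSumℕ k s₁
      B₂ = binomSumℕ k s₂
      c₁ = count p k s₁
      c₂ = count p k s₂
      Q = (p ∸ 2) ^ k
      W T : ℤ
      W = (+ 2 - + p) ℤ.^ k
      T = (+ 2) ℤ.^ k
      split : ∀ p x y w t → p ℤ.* (x ℤ.+ y) ℤ.+ (+ 2 - p) ℤ.* w - + 2 ℤ.* t ≡ (p ℤ.* x ℤ.+ w - t) ℤ.+ (p ℤ.* y ℤ.+ w - t) - p ℤ.* w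
      split = ℤ-Ring.solve-∀
      collect : ∀ σ p c₁ c₂ q → σ ℤ.* (p ℤ.* c₁) ℤ.+ σ ℤ.* (p ℤ.* c₂) - p ℤ.* (σ ℤ.* q) ≡ ((- + 1) ℤ.* σ) ℤ.* (p ℤ.* (q - c₁ - c₂))
      collect = ℤ-Ring.solve-∀

    binomSum-formula : ∀ k s → + p ℤ.* binomSum k a₁ a₂ b₁ b₂ s p ℤ.+ (+ 2 - + p) ℤ.^ k - (+ 2) ℤ.^ k ≡ σ k ℤ.* (+ p ℤ.* + count p k s)
    binomSum-formula k s = trans (cong (λ z → + p ℤ.* z ℤ.+ (+ 2 - + p) ℤ.^ k - (+ 2) ℤ.^ k) (binomSum≡binomSumℕ k s)) (Φ-closed k s)

  count-multiplicative : ∀ k s → Multiplicative (λ u → count u k s)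
  count-multiplicative k s = record { F-1 = count-mod-1 k s ; F-* = λ u v u⊥v → count-* u v u⊥v k s }

  localFactor≡count : ∀ k c n q .{{_ : NonZero n}} → Prime q → q ∣ n →
                      Coprime ∣ a₁ ∣ q → Coprime ∣ b₁ ∣ q → Coprime ∣ a₁ ℤ.* b₂ - a₂ ℤ.* b₁ ∣ q →
                      localFactor (suc k) a₁ a₂ b₁ b₂ c n q ≡ ((- + 1) ℤ.^ suc k ℤ.* + count (q ^ ν q n) (suc k) c) / 1
  localFactor≡count k c n q q-prime q∣n a₁⊥q b₁⊥q Δ⊥q with p-part (prime>1 q-prime) n
  ... | zero  , m , n≡m , q∤m = contradiction (subst (q ∣_) (trans n≡m (+-identityʳ m)) q∣n) q∤m
  ... | suc e , m , n≡q^[1+e]*m , q∤m = begin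
    zpow q (+ (K * ν q n) - + ν q n - + K) ℚ.* (X / 1)
      ≡⟨ cong₂ (λ v z → zpow q (+ (K * v) - + v - + K) ℚ.* (z / 1)) ν≡ (binomSum-formula K c) ⟩
    zpow q (+ (K * suc e) - + suc e - + K) ℚ.* ((σ K ℤ.* (+ q ℤ.* + C)) / 1)
      ≡⟨ cong₂ (λ x z → zpow q x ℚ.* (z / 1)) exponent (swap (σ K) (+ q) (+ C)) ⟩
    zpow q (+ (k * e) - + 1) ℚ.* ((+ q ℤ.* (σ K ℤ.* + C)) / 1)
      ≡⟨ zpow-pred-* q {{prime⇒nonZero q-prime}} (k * e) (σ K ℤ.* + C) ⟩
    (+ (q ^ (k * e)) ℤ.* (σ K ℤ.* + C)) / 1
      ≡⟨ cong (_/ 1) (trans (swap′ (+ (q ^ (k * e))) (σ K) (+ C)) (cong (σ K ℤ.*_) (sym (ℤ.pos-* (q ^ (k * e)) C)))) ⟩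
    (σ K ℤ.* + (q ^ (k * e) * C)) / 1
      ≡⟨ cong (λ z → (σ K ℤ.* + z) / 1) (count-^ q {{prime⇒nonZero q-prime}} e k c) ⟨
    (σ K ℤ.* + count (q ^ suc e) K c) / 1
      ≡⟨ cong (λ v → (σ K ℤ.* + count (q ^ v) K c) / 1) ν≡ ⟨
    (σ K ℤ.* + count (q ^ ν q n) K c) / 1
      ∎
    where
    open ≡-Reasoning
    open ModuloPrime q q-prime a₁⊥q b₁⊥q Δ⊥q using (σ; binomSum-formula)
    K C : ℕ
    K = suc k
    C = count q K c
    X : ℤ
    X = + q ℤ.* binomSum K a₁ a₂ b₁ b₂ c q ℤ.+ (+ 2 - + q) ℤ.^ K - (+ 2) ℤ.^ K
    ν≡ : ν q n ≡ suc e
    ν≡ = ν-unique (prime>1 q-prime) n (suc e) m n≡q^[1+e]*m q∤m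
    exponent : + (K * suc e) - + suc e - + K ≡ + (k * e) - + 1
    exponent = begin
      + (K * suc e) - + suc e - + K                                 ≡⟨ cong (λ z → z - + suc e - + K) (ℤ.pos-* K (suc e)) ⟩
      + K ℤ.* + suc e - + suc e - + K                               ≡⟨ cong₂ (λ a b → a ℤ.* b - b - a) (ℤ.pos-+ 1 k) (ℤ.pos-+ 1 e) ⟩
      (+ 1 ℤ.+ + k) ℤ.* (+ 1 ℤ.+ + e) - (+ 1 ℤ.+ + e) - (+ 1 ℤ.+ + k) ≡⟨ expand (+ k) (+ e) ⟩
      + k ℤ.* + e - + 1                                             ≡⟨ cong (_- + 1) (ℤ.pos-* k e) ⟨
      + (k * e) - + 1                                               ∎
      where
      expand : ∀ k e → (+ 1 ℤ.+ k) ℤ.* (+ 1 ℤ.+ e) - (+ 1 ℤ.+ e) - (+ 1 ℤ.+ k) ≡ k ℤ.* e - + 1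
      expand = ℤ-Ring.solve-∀
    swap : ∀ s q x → s ℤ.* (q ℤ.* x) ≡ q ℤ.* (s ℤ.* x)
    swap = ℤ-Ring.solve-∀
    swap′ : ∀ a s x → a ℤ.* (s ℤ.* x) ≡ s ℤ.* (a ℤ.* x)
    swap′ = ℤ-Ring.solve-∀

prodℚ-map-/1 : ∀ L (F : ℕ → ℚ) (σ : ℤ) (G : ℕ → ℕ) → (∀ {q} → q ∈ L → F q ≡ (σ ℤ.* + G q) / 1) →
               prodℚ (map F L) ≡ (σ ℤ.^ length L ℤ.* + product (map G L)) / 1
prodℚ-map-/1 []      F σ G F≡ = refl
prodℚ-map-/1 (q ∷ L) F σ G F≡ = begin
  F q ℚ.* prodℚ (map F L)                                                ≡⟨ cong₂ ℚ._*_ (F≡ (here refl)) (prodℚ-map-/1 L F σ G (F≡ ∘ there)) ⟩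
  ((σ ℤ.* + G q) / 1) ℚ.* ((σ ℤ.^ length L ℤ.* + product (map G L)) / 1) ≡⟨ /1-* (σ ℤ.* + G q) _ ⟩
  ((σ ℤ.* + G q) ℤ.* (σ ℤ.^ length L ℤ.* + product (map G L))) / 1       ≡⟨ cong (_/ 1) (interchange σ (+ G q) (σ ℤ.^ length L) (+ product (map G L))) ⟩
  (σ ℤ.^ suc (length L) ℤ.* (+ G q ℤ.* + product (map G L))) / 1         ≡⟨ cong (λ z → (σ ℤ.^ suc (length L) ℤ.* z) / 1) (ℤ.pos-* (G q) _) ⟨
  (σ ℤ.^ suc (length L) ℤ.* + product (map G (q ∷ L))) / 1               ∎
  where
  open ≡-Reasoning
  interchange : ∀ s g t x → (s ℤ.* g) ℤ.* (t ℤ.* x) ≡ (s ℤ.* t) ℤ.* (g ℤ.* x)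
  interchange = ℤ-Ring.solve-∀

-1^-cancel : ∀ k w x → (- + 1) ℤ.^ (k * w) ℤ.* (((- + 1) ℤ.^ k) ℤ.^ w ℤ.* x) ≡ x
-1^-cancel k w x = begin
  τ ℤ.* (((- + 1) ℤ.^ k) ℤ.^ w ℤ.* x)   ≡⟨ cong (λ z → τ ℤ.* (z ℤ.* x)) (ℤ.^-*-assoc (- + 1) k w) ⟩
  τ ℤ.* (τ ℤ.* x)                      ≡⟨ ℤ.*-assoc τ τ x ⟨
  τ ℤ.* τ ℤ.* x                        ≡⟨ cong (ℤ._* x) (^-distrib-* (- + 1) (- + 1) (k * w)) ⟨
  (+ 1) ℤ.^ (k * w) ℤ.* x              ≡⟨ cong (ℤ._* x) (ℤ.^-zeroˡ (k * w)) ⟩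
  + 1 ℤ.* x                            ≡⟨ ℤ.*-identityˡ x ⟩
  x                                    ∎
  where
  open ≡-Reasoning
  τ : ℤ
  τ = (- + 1) ℤ.^ (k * w)

gcd≡1⇒coprime-∣ : ∀ a {n q} → gcd a (+ n) ≡ + 1 → q ∣ n → Coprime ∣ a ∣ q
gcd≡1⇒coprime-∣ a gcd≡1 q∣n = coprime-∣ʳ (gcd≡1⇒coprime (ℤ.+-injective gcd≡1)) q∣n

theorem1p3 : (k : ℕ) → 2 ≤ k → (c : ℤ) → (n : ℕ) → 1 ≤ n →
    (a₁ a₂ b₁ b₂ : ℤ) →
    gcd a₁ (+ n) ≡ + 1 → gcd b₁ (+ n) ≡ + 1 →
    gcd (a₁ ℤ.* b₂ - a₂ ℤ.* b₁) (+ n) ≡ + 1 →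
    (+ 𝒩 k a₁ a₂ b₁ b₂ c n) / 1 ≡ rhs k a₁ a₂ b₁ b₂ c n
theorem1p3 (suc k) _ c n 1≤n a₁ a₂ b₁ b₂ a₁⊥n b₁⊥n Δ⊥n = begin
  (+ 𝒩 K a₁ a₂ b₁ b₂ c n) / 1                                         ≡⟨ cong (λ z → (+ z) / 1) N≡∏ ⟩
  (+ product (map G L)) / 1                                           ≡⟨ cong (_/ 1) (-1^-cancel K (ω n) _) ⟨
  (τ ℤ.* (σ ℤ.^ ω n ℤ.* + product (map G L))) / 1                      ≡⟨ /1-* τ _ ⟨
  (τ / 1) ℚ.* ((σ ℤ.^ ω n ℤ.* + product (map G L)) / 1)                ≡⟨ cong ((τ / 1) ℚ.*_) (prodℚ-map-/1 L _ σ G local) ⟨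
  rhs K a₁ a₂ b₁ b₂ c n                                               ∎
  where
  open ≡-Reasoning
  open Exunits a₁ a₂ b₁ b₂
  instance
    n≢0 : NonZero n
    n≢0 = >-nonZero 1≤n
  K : ℕ
  K = suc k
  L : List ℕ
  L = primeDivisors n
  σ τ : ℤ
  σ = (- + 1) ℤ.^ K
  τ = (- + 1) ℤ.^ (K * ω n)
  G : ℕ → ℕ
  G q = count (q ^ ν q n) K c
  N≡∏ : 𝒩 K a₁ a₂ b₁ b₂ c n ≡ product (map G L)
  N≡∏ = trans (𝒩≡count n K c) (multiplicative-factorisation (count-multiplicative K c) n (primeDivisors-list n))
  local : ∀ {q} → q ∈ L → localFactor K a₁ a₂ b₁ b₂ c n q ≡ (σ ℤ.* + G q) / 1
  local q∈L with Equivalence.to (PrimeDivisorList.members (primeDivisors-list n)) q∈L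
  ... | q-prime , q∣n = localFactor≡count k c n _ q-prime q∣n
                          (gcd≡1⇒coprime-∣ a₁ a₁⊥n q∣n) (gcd≡1⇒coprime-∣ b₁ b₁⊥n q∣n)
                          (gcd≡1⇒coprime-∣ (a₁ ℤ.* b₂ - a₂ ℤ.* b₁) Δ⊥n q∣n)
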